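{- Let $k,n,s\in\mathbb{N}$ and let $a_1,\ldots,a_k\in\mathbb{Z}$ with $(a_i,n^s)_s=1$ for all $i$. Then $$\sum_{\substack{1\le m_1,\ldots,m_k\le n^s\\ (m_i,n^s)_s=1\ (i=1,\ldots,k)}}(m_1-a_1,\ldots,m_k-a_k,n^s)_s = \Phi_s(n^s)^k\sum_{d^s\mid n^s}\frac{1}{\Phi_s(d^s)^{k-1}},$$ where the right-hand sum is over positive integers $d$ with $d^s\mid n^s$.
   Context: $\mathbb{N}$ denotes the positive integers. For a positive integer $s$ and integers not all zero, $(x_1,\ldots,x_m)_s$ denotes the largest $l^s$ with $l\in\mathbb{N}$ dividing all of $x_1,\ldots,x_m$. Klee's function $\Phi_s(n)$ is the number of integers $m$ with $1\le m\le n$ and $(m,n)_s=1$. -}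

module Defs where

open import Data.Nat using (ℕ; zero; suc; _+_; _^_; _∸_; _≟_)
open import Data.Nat.Divisibility using (_∣_; _∣?_)
open import Data.Integer as ℤ using (ℤ; ∣_∣)
open import Data.Rational as ℚ using (ℚ; 0ℚ; 1ℚ)
open import Data.List using (List; []; _∷_; map; filter; upTo; concatMap; foldr)
open import Data.List.Relation.Unary.All using (All)
open import Data.List.Relation.Unary.All as All using (all?)
open import Data.Vec as Vec using (Vec)
open import Relation.Nullary using (does)
open import Data.Bool using (if_then_else_)

PowDividesAll : ℕ → List ℤ → ℕ → Set
PowDividesAll s xs l = All (λ x → (l ^ s) ∣ ∣ x ∣) xs

largestPowFrom : ℕ → List ℤ → ℕ → ℕ
largestPowFrom s xs zero = 1
largestPowFrom s xs (suc l) =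
  if does (all? (λ x → (suc l ^ s) ∣? ∣ x ∣) xs)
  then suc l ^ s
  else largestPowFrom s xs l

-- (x_1,...,x_m)_s : the largest l^s (l ∈ ℕ positive) dividing all x_i.
-- Search bound: sum of |x_i|; when some x_i ≠ 0 and s ≥ 1, any valid l
-- satisfies l ≤ l^s ≤ |x_i| ≤ bound, so this is the largest such l^s.
gcdₛ : ℕ → List ℤ → ℕ
gcdₛ s xs = largestPowFrom s xs (foldr (λ x acc → ∣ x ∣ + acc) 0 xs)

range1 : ℕ → List ℕ
range1 N = map suc (upTo N)

reducedₛ : ℕ → ℕ → List ℕ
reducedₛ s N = filter (λ m → gcdₛ s (ℤ.+ m ∷ ℤ.+ N ∷ []) ≟ 1) (range1 N)

Φ : ℕ → ℕ → ℕ
Φ s N = Data.List.length (reducedₛ s N)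

tuples : (k : ℕ) → List ℕ → List (Vec ℕ k)
tuples zero L = Vec.[] ∷ []
tuples (suc k) L = concatMap (λ m → map (m Vec.∷_) (tuples k L)) L

sumℕ : List ℕ → ℕ
sumℕ = foldr _+_ 0

sumℚ : List ℚ → ℚ
sumℚ = foldr ℚ._+_ 0ℚ

toℚ : ℕ → ℚ
toℚ n = ℤ.+ n ℚ./ 1

-- reciprocal 1/n of a natural number (only applied to n ≥ 1 below, since Φ_s(d^s) ≥ 1;
-- the value at 0 is an irrelevant convention)
recipℕ : ℕ → ℚ
recipℕ zero = 0ℚ
recipℕ (suc n) = ℤ.+ 1 ℚ./ suc n

lhs : (k n s : ℕ) → Vec ℤ k → ℕ
lhs k n s as =
  sumℕ (map (λ ms → gcdₛ s (Vec.toList (Vec.zipWith (λ m a → ℤ.+ m ℤ.- a) ms as)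
                             Data.List.++ (ℤ.+ (n ^ s) ∷ [])))
            (tuples k (reducedₛ s (n ^ s))))

-- positive d with d^s ∣ n^s (such d satisfy d ≤ d^s ≤ n^s when s ≥ 1)
divisorsₛ : ℕ → ℕ → List ℕ
divisorsₛ n s = filter (λ d → (d ^ s) ∣? (n ^ s)) (range1 (n ^ s))

rhs : (k n s : ℕ) → ℚ
rhs k n s = toℚ (Φ s (n ^ s) ^ k) ℚ.* sumℚ (map (λ d → recipℕ (Φ s (d ^ s) ^ (k ∸ 1))) (divisorsₛ n s))

-- Write (m₁ - a₁, …, m_k - a_k, n ^ s)_s = g ^ s. The Jordan-type identity g ^ s = ∑_{j ∣ g} Φ_s(j ^ s),
-- together with "l ∣ g iff l ^ s divides n ^ s and every mᵢ - aᵢ", turns the left-hand side into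
-- ∑_{d ^ s ∣ n ^ s} Φ_s(d ^ s) ∏ᵢ #{m ≤ n ^ s reduced : m ≡ aᵢ (mod d ^ s)}. Each factor equals
-- Φ_s(n ^ s) / Φ_s(d ^ s): the reduced residues mod n ^ s fibre over those mod d ^ s, and all fibres have
-- the same size, since translating by a t with t ≡ a - a′ (mod d ^ s) and p ^ s ∣ t for every prime p ∣ n
-- not dividing d (Chinese remainder theorem) maps the fibre over a′ onto the fibre over a.

module Submission where

open import Defs
open import Data.Nat using (ℕ; _≥_; _^_)
open import Data.Integer using (ℤ)
open import Data.Fin using (Fin)
open import Data.Vec using (Vec; lookup)
open import Data.List using (_∷_; [])
open import Relation.Binary.PropositionalEquality using (_≡_)

open import Data.Nat
open import Data.Nat.Properties
open import Data.Nat.Divisibility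
open import Data.Nat.DivMod using (m*[n/m]≡n)
open import Data.Nat.GCD using (gcd; gcd[m,n]∣m; gcd[m,n]∣n; gcd[m,n]≢0; module Bézout)
open import Data.Nat.Coprimality as Coprime using (Coprime; coprime-divisor; coprime-/gcd; gcd≡1⇒coprime; coprime-Bézout)
open import Data.Nat.Primality using (Prime; euclidsLemma; prime⇒nonTrivial)
open import Data.Nat.Primality.Factorisation using (factorise)
open import Data.Nat.ListAction using (product)
open import Data.Nat.Tactic.RingSolver using (solve-∀)
open import Data.Integer as ℤ using (∣_∣; -[1+_])
import Data.Integer.Properties as ℤ
import Data.Integer.Divisibility.Signed as ℤ
import Data.Integer.Tactic.RingSolver as ℤ
open import Data.Rational as ℚ using (ℚ; 0ℚ)
import Data.Rational.Properties as ℚ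
open import Data.Rational.Unnormalised as ℚᵘ using (mkℚᵘ; *≡*)
import Data.Rational.Unnormalised.Properties as ℚᵘ
open import Data.List using (List; map; filter; upTo; applyUpTo; length; _++_; concat; foldr)
open import Data.List.Relation.Unary.All as All using (All; all?; []; _∷_)
import Data.List.Relation.Unary.All.Properties as All
open import Data.List.Relation.Unary.Any using (here; there)
open import Data.List.Membership.Propositional using (_∈_)
open import Data.List.Membership.Propositional.Properties using (∈-++⁺ʳ)
import Data.Fin as Fin
open import Data.Vec as Vec using ([]; _∷_)
open import Data.Product using (∃-syntax; _×_; _,_; proj₁; proj₂)
open import Data.Sum using (inj₁; inj₂)
open import Data.Empty using (⊥-elim)
open import Relation.Nullary using (Dec; yes; no; ¬_; _×-dec_)
open import Relation.Binary.PropositionalEquality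
open import Relation.Binary.Definitions using (tri<; tri≈; tri>)
open import Function using (_∘_; id)

-- Finite sums and indicators

𝟙 : ∀ {p} {P : Set p} → Dec P → ℕ
𝟙 (yes _) = 1
𝟙 (no _)  = 0

module _ {p q} {P : Set p} {Q : Set q} where

  𝟙-cong : (P → Q) → (Q → P) → (P? : Dec P) (Q? : Dec Q) → 𝟙 P? ≡ 𝟙 Q?
  𝟙-cong f g (yes _) (yes _) = refl
  𝟙-cong f g (yes p) (no ¬q) = ⊥-elim (¬q (f p))
  𝟙-cong f g (no ¬p) (yes q) = ⊥-elim (¬p (g q))
  𝟙-cong f g (no _)  (no _)  = refl

  𝟙-× : (P? : Dec P) (Q? : Dec Q) → 𝟙 (P? ×-dec Q?) ≡ 𝟙 P? * 𝟙 Q?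
  𝟙-× (yes _) (yes _) = refl
  𝟙-× (yes _) (no _)  = refl
  𝟙-× (no _)  _       = refl

module _ {p} {P : Set p} where

  𝟙-yes : (P? : Dec P) → P → 𝟙 P? ≡ 1
  𝟙-yes (yes _) _ = refl
  𝟙-yes (no ¬p) p = ⊥-elim (¬p p)

  𝟙-no : (P? : Dec P) → ¬ P → 𝟙 P? ≡ 0
  𝟙-no (yes p) ¬p = ⊥-elim (¬p p)
  𝟙-no (no _)  _  = refl

  𝟙-*-cong : ∀ {m m′} (P? : Dec P) → (P → m ≡ m′) → 𝟙 P? * m ≡ 𝟙 P? * m′
  𝟙-*-cong (yes p) m≡m′ = cong (_+ 0) (m≡m′ p)
  𝟙-*-cong (no _)  _    = refl

∑ : ∀ {a} {A : Set a} → List A → (A → ℕ) → ℕ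
∑ xs f = sumℕ (map f xs)

syntax ∑ xs (λ x → e) = ∑[ x ∈ xs ] e

∑< : ℕ → (ℕ → ℕ) → ℕ
∑< zero    f = 0
∑< (suc N) f = ∑< N f + f N

syntax ∑< N (λ i → e) = ∑[ i < N ] e

module _ {a} {A : Set a} where

  ∑-cong : (xs : List A) {f g : A → ℕ} → (∀ x → f x ≡ g x) → ∑ xs f ≡ ∑ xs g
  ∑-cong []       e = refl
  ∑-cong (x ∷ xs) e = cong₂ _+_ (e x) (∑-cong xs e)

  ∑-+ : (xs : List A) (f g : A → ℕ) → ∑[ x ∈ xs ] (f x + g x) ≡ ∑ xs f + ∑ xs g
  ∑-+ []       f g = refl
  ∑-+ (x ∷ xs) f g rewrite ∑-+ xs f g = interchange (f x) (g x) (∑ xs f) (∑ xs g)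
    where
    interchange : ∀ a b c d → (a + b) + (c + d) ≡ (a + c) + (b + d)
    interchange = solve-∀

  ∑-*ˡ : (xs : List A) (c : ℕ) (f : A → ℕ) → ∑[ x ∈ xs ] (c * f x) ≡ c * ∑ xs f
  ∑-*ˡ []       c f = sym (*-zeroʳ c)
  ∑-*ˡ (x ∷ xs) c f rewrite ∑-*ˡ xs c f = sym (*-distribˡ-+ c (f x) (∑ xs f))

  ∑-*ʳ : (xs : List A) (c : ℕ) (f : A → ℕ) → ∑[ x ∈ xs ] (f x * c) ≡ ∑ xs f * c
  ∑-*ʳ xs c f = begin
    ∑[ x ∈ xs ] (f x * c)  ≡⟨ ∑-cong xs (λ x → *-comm (f x) c) ⟩
    ∑[ x ∈ xs ] (c * f x)  ≡⟨ ∑-*ˡ xs c f ⟩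
    c * ∑ xs f             ≡⟨ *-comm c _ ⟩
    ∑ xs f * c             ∎
    where open ≡-Reasoning

  ∑-zero : (xs : List A) → ∑[ x ∈ xs ] 0 ≡ 0
  ∑-zero []       = refl
  ∑-zero (x ∷ xs) = ∑-zero xs

  ∑-++ : (xs ys : List A) (f : A → ℕ) → ∑ (xs ++ ys) f ≡ ∑ xs f + ∑ ys f
  ∑-++ []       ys f = refl
  ∑-++ (x ∷ xs) ys f rewrite ∑-++ xs ys f = sym (+-assoc (f x) _ _)

  ∑-filter : ∀ {p} {P : A → Set p} (P? : ∀ x → Dec (P x)) (xs : List A) (f : A → ℕ) →
             ∑ (filter P? xs) f ≡ ∑[ x ∈ xs ] (𝟙 (P? x) * f x)
  ∑-filter P? []       f = refl
  ∑-filter P? (x ∷ xs) f with P? x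
  ... | yes _ = cong₂ _+_ (sym (+-identityʳ (f x))) (∑-filter P? xs f)
  ... | no _  = ∑-filter P? xs f

  length-filter : ∀ {p} {P : A → Set p} (P? : ∀ x → Dec (P x)) (xs : List A) →
                  length (filter P? xs) ≡ ∑[ x ∈ xs ] 𝟙 (P? x)
  length-filter P? []       = refl
  length-filter P? (x ∷ xs) with P? x
  ... | yes _ = cong suc (length-filter P? xs)
  ... | no _  = length-filter P? xs

∑-swap : ∀ {a b} {A : Set a} {B : Set b} (xs : List A) (ys : List B) (f : A → B → ℕ) →
         ∑[ x ∈ xs ] ∑ ys (f x) ≡ ∑[ y ∈ ys ] ∑[ x ∈ xs ] f x y
∑-swap []       ys f = sym (∑-zero ys)
∑-swap (x ∷ xs) ys f rewrite ∑-swap xs ys f = sym (∑-+ ys (f x) (λ y → ∑[ x ∈ xs ] f x y))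

∑-map : ∀ {a b} {A : Set a} {B : Set b} (xs : List A) (g : A → B) (f : B → ℕ) →
        ∑ (map g xs) f ≡ ∑ xs (f ∘ g)
∑-map []       g f = refl
∑-map (x ∷ xs) g f = cong (f (g x) +_) (∑-map xs g f)

∑-concat : ∀ {a} {A : Set a} (xss : List (List A)) (f : A → ℕ) →
           ∑ (concat xss) f ≡ ∑[ xs ∈ xss ] ∑ xs f
∑-concat []         f = refl
∑-concat (xs ∷ xss) f = trans (∑-++ xs (concat xss) f) (cong (∑ xs f +_) (∑-concat xss f))

∑<-cong : ∀ N {f g : ℕ → ℕ} → (∀ i → i < N → f i ≡ g i) → ∑< N f ≡ ∑< N g
∑<-cong zero    e = refl
∑<-cong (suc N) e = cong₂ _+_ (∑<-cong N (λ i i<N → e i (m<n⇒m<1+n i<N))) (e N ≤-refl)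

∑<-suc : ∀ N f → ∑< (suc N) f ≡ f 0 + ∑< N (f ∘ suc)
∑<-suc zero    f = +-comm 0 (f 0)
∑<-suc (suc N) f rewrite ∑<-suc N f = +-assoc (f 0) _ _

∑<-+ : ∀ M N (f : ℕ → ℕ) → ∑< (M + N) f ≡ ∑< M f + ∑[ i < N ] f (M + i)
∑<-+ M zero    f rewrite +-identityʳ M = sym (+-identityʳ _)
∑<-+ M (suc N) f rewrite +-suc M N | ∑<-+ M N f = +-assoc (∑< M f) _ _

∑<-zero : ∀ N (f : ℕ → ℕ) → (∀ i → i < N → f i ≡ 0) → ∑< N f ≡ 0
∑<-zero zero    f e = refl
∑<-zero (suc N) f e rewrite ∑<-zero N f (λ i i<N → e i (m<n⇒m<1+n i<N)) | e N ≤-refl = refl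

∑<-const : ∀ N c → ∑[ _ < N ] c ≡ N * c
∑<-const zero    c = refl
∑<-const (suc N) c rewrite ∑<-const N c = +-comm (N * c) c

∑<-*ˡ : ∀ N c (f : ℕ → ℕ) → ∑[ i < N ] (c * f i) ≡ c * ∑< N f
∑<-*ˡ zero    c f = sym (*-zeroʳ c)
∑<-*ˡ (suc N) c f rewrite ∑<-*ˡ N c f = sym (*-distribˡ-+ c (∑< N f) (f N))

∑<-*ʳ : ∀ N c (f : ℕ → ℕ) → ∑[ i < N ] (f i * c) ≡ ∑< N f * c
∑<-*ʳ N c f = begin
  ∑[ i < N ] (f i * c)  ≡⟨ ∑<-cong N (λ i _ → *-comm (f i) c) ⟩
  ∑[ i < N ] (c * f i)  ≡⟨ ∑<-*ˡ N c f ⟩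
  c * ∑< N f            ≡⟨ *-comm c _ ⟩
  ∑< N f * c            ∎
  where open ≡-Reasoning

∑-applyUpTo : ∀ N (h : ℕ → ℕ) (f : ℕ → ℕ) → ∑ (applyUpTo h N) f ≡ ∑< N (f ∘ h)
∑-applyUpTo zero    h f = refl
∑-applyUpTo (suc N) h f =
  trans (cong (f (h 0) +_) (∑-applyUpTo N (h ∘ suc) f)) (sym (∑<-suc N (f ∘ h)))

∑-upTo : ∀ N (f : ℕ → ℕ) → ∑ (upTo N) f ≡ ∑< N f
∑-upTo N f = ∑-applyUpTo N id f

∑-range1 : ∀ N (f : ℕ → ℕ) → ∑ (range1 N) f ≡ ∑[ i < N ] f (suc i)
∑-range1 N f = trans (∑-map (upTo N) suc f) (∑-upTo N (f ∘ suc))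

∑-∑<-swap : ∀ {a} {A : Set a} (xs : List A) N (f : A → ℕ → ℕ) →
            ∑[ x ∈ xs ] ∑< N (f x) ≡ ∑[ i < N ] ∑[ x ∈ xs ] f x i
∑-∑<-swap xs N f = begin
  ∑[ x ∈ xs ] ∑< N (f x)              ≡⟨ ∑-cong xs (λ x → sym (∑-upTo N (f x))) ⟩
  ∑[ x ∈ xs ] ∑ (upTo N) (f x)        ≡⟨ ∑-swap xs (upTo N) f ⟩
  ∑[ i ∈ upTo N ] ∑[ x ∈ xs ] f x i   ≡⟨ ∑-upTo N _ ⟩
  ∑[ i < N ] ∑[ x ∈ xs ] f x i        ∎
  where open ≡-Reasoning

∑<-swap : ∀ M N (f : ℕ → ℕ → ℕ) → ∑[ i < M ] ∑< N (f i) ≡ ∑[ j < N ] ∑[ i < M ] f i j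
∑<-swap M N f = begin
  ∑[ i < M ] ∑< N (f i)            ≡⟨ sym (∑-upTo M _) ⟩
  ∑[ i ∈ upTo M ] ∑< N (f i)       ≡⟨ ∑-∑<-swap (upTo M) N f ⟩
  ∑[ j < N ] ∑[ i ∈ upTo M ] f i j ≡⟨ ∑<-cong N (λ j _ → ∑-upTo M (λ i → f i j)) ⟩
  ∑[ j < N ] ∑[ i < M ] f i j      ∎
  where open ≡-Reasoning

∑<-𝟙-unique : ∀ N v {p} {P : ℕ → Set p} (P? : ∀ i → Dec (P i)) → v < N → P v →
              (∀ i → i < N → P i → i ≡ v) → ∑[ i < N ] 𝟙 (P? i) ≡ 1
∑<-𝟙-unique (suc N) v P? v<1+N Pv unique with m<1+n⇒m<n∨m≡n v<1+N
... | inj₂ refl = cong₂ _+_ others (𝟙-yes (P? N) Pv)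
  where
  others : ∑[ i < N ] 𝟙 (P? i) ≡ 0
  others = ∑<-zero N _ (λ i i<N → 𝟙-no (P? i) (λ Pi → <-irrefl (unique i (m<n⇒m<1+n i<N) Pi) i<N))
... | inj₁ v<N = cong₂ _+_
  (∑<-𝟙-unique N v P? v<N Pv (λ i i<N → unique i (m<n⇒m<1+n i<N)))
  (𝟙-no (P? N) (λ PN → <-irrefl (sym (unique N ≤-refl PN)) v<N))

-- Powers and coprimality

1≤m*n⇒1≤m : ∀ {m n} → 1 ≤ m * n → 1 ≤ m
1≤m*n⇒1≤m {suc m} _ = s≤s z≤n

1≤m*n⇒1≤n : ∀ {m n} → 1 ≤ m * n → 1 ≤ n
1≤m*n⇒1≤n {m} {n} p rewrite *-comm m n = 1≤m*n⇒1≤m p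

^-distribʳ-* : ∀ s m n → (m * n) ^ s ≡ m ^ s * n ^ s
^-distribʳ-* zero    m n = refl
^-distribʳ-* (suc s) m n rewrite ^-distribʳ-* s m n = interchange m n (m ^ s) (n ^ s)
  where
  interchange : ∀ a b c d → a * b * (c * d) ≡ a * c * (b * d)
  interchange = solve-∀

^-pres-∣ : ∀ s {m n} → m ∣ n → m ^ s ∣ n ^ s
^-pres-∣ zero    _   = ∣-refl
^-pres-∣ (suc s) m∣n = *-pres-∣ m∣n (^-pres-∣ s m∣n)

1≤m^n : ∀ s {m} → 1 ≤ m → 1 ≤ m ^ s
1≤m^n s {suc m} _ = m^n>0 (suc m) s

m≤m^n : ∀ s {m} → 1 ≤ s → 1 ≤ m → m ≤ m ^ s
m≤m^n (suc s) {m} _ 1≤m = subst (_≤ m * m ^ s) (*-identityʳ m) (*-monoʳ-≤ m (1≤m^n s 1≤m))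

m^n≡1⇒m≡1 : ∀ s {m} → 1 ≤ s → m ^ s ≡ 1 → m ≡ 1
m^n≡1⇒m≡1 s 1≤s e with m^n≡1⇒n≡0∨m≡1 _ s e
... | inj₁ refl = ⊥-elim (<-irrefl refl 1≤s)
... | inj₂ m≡1  = m≡1

^-injectiveˡ : ∀ s {m n} → 1 ≤ s → m ^ s ≡ n ^ s → m ≡ n
^-injectiveˡ s {m} {n} 1≤s e with <-cmp m n
... | tri≈ _ m≡n _ = m≡n
... | tri< m<n _ _ = ⊥-elim (<-irrefl e (^-monoˡ-< s {{>-nonZero 1≤s}} m<n))
... | tri> _ _ n<m = ⊥-elim (<-irrefl (sym e) (^-monoˡ-< s {{>-nonZero 1≤s}} n<m))

coprime-*ʳ : ∀ {m n o} → Coprime m n → Coprime m o → Coprime m (n * o)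
coprime-*ʳ {m} {n} {o} m⊥n m⊥o {i} (i∣m , i∣no) = m⊥o (i∣m , coprime-divisor i⊥n i∣no)
  where
  i⊥n : Coprime i n
  i⊥n (j∣i , j∣n) = m⊥n (∣-trans j∣i i∣m , j∣n)

coprime-^ʳ : ∀ s {m n} → Coprime m n → Coprime m (n ^ s)
coprime-^ʳ zero    _   (_ , i∣1) = ∣1⇒≡1 i∣1
coprime-^ʳ (suc s) m⊥n = coprime-*ʳ m⊥n (coprime-^ʳ s m⊥n)

coprime-^ : ∀ s {m n} → Coprime m n → Coprime (m ^ s) (n ^ s)
coprime-^ s m⊥n = Coprime.sym (coprime-^ʳ s (Coprime.sym (coprime-^ʳ s m⊥n)))

record CoprimeSplit (d e : ℕ) : Set where
  field
    g d′ e′ : ℕ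
    1≤g     : 1 ≤ g
    d≡g*d′  : d ≡ g * d′
    e≡g*e′  : e ≡ g * e′
    d′⊥e′   : Coprime d′ e′

swapSplit : ∀ {d e} → CoprimeSplit d e → CoprimeSplit e d
swapSplit sp = record { g = g ; d′ = e′ ; e′ = d′ ; 1≤g = 1≤g ; d≡g*d′ = e≡g*e′ ; e≡g*e′ = d≡g*d′ ; d′⊥e′ = Coprime.sym d′⊥e′ }
  where open CoprimeSplit sp

coprimeSplit : ∀ d e → 1 ≤ d → CoprimeSplit d e
coprimeSplit d e 1≤d = record
  { g = gcd d e ; d′ = d / gcd d e ; e′ = e / gcd d e ; 1≤g = 1≤gcd
  ; d≡g*d′ = sym (m*[n/m]≡n (gcd[m,n]∣m d e))
  ; e≡g*e′ = sym (m*[n/m]≡n (gcd[m,n]∣n d e))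
  ; d′⊥e′ = coprime-/gcd d e }
  where
  1≤gcd : 1 ≤ gcd d e
  1≤gcd = n≢0⇒n>0 (gcd[m,n]≢0 d e (inj₁ (λ d≡0 → <-irrefl (sym d≡0) 1≤d)))
  instance
    gcd≢0 : NonZero (gcd d e)
    gcd≢0 = >-nonZero 1≤gcd

-- Writing d = g d′ and e = g e′ with d′ ⊥ e′, the factor g ^ s cancels and d′ ^ s ⊥ e′ ^ s.
split-^-∣ : ∀ s {d e y} (sp : CoprimeSplit d e) → d ^ s ∣ e ^ s * y → CoprimeSplit.d′ sp ^ s ∣ y
split-^-∣ s {d} {e} {y} sp d^s∣e^sy =
  coprime-divisor (coprime-^ s d′⊥e′) (*-cancelˡ-∣ (g ^ s) {{>-nonZero (1≤m^n s 1≤g)}} cancelled)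
  where
  open CoprimeSplit sp
  cancelled : g ^ s * d′ ^ s ∣ g ^ s * (e′ ^ s * y)
  cancelled = subst₂ _∣_
    (trans (cong (_^ s) d≡g*d′) (^-distribʳ-* s g d′))
    (trans (cong (λ z → z ^ s * y) e≡g*e′) (trans (cong (_* y) (^-distribʳ-* s g e′)) (*-assoc (g ^ s) (e′ ^ s) y)))
    d^s∣e^sy

^∣^⇒∣ : ∀ s {d e} → 1 ≤ s → 1 ≤ d → d ^ s ∣ e ^ s → d ∣ e
^∣^⇒∣ s {d} {e} 1≤s 1≤d d^s∣e^s =
  subst₂ _∣_ (sym (trans d≡g*d′ (trans (cong (g *_) d′≡1) (*-identityʳ g)))) (sym e≡g*e′) (m∣m*n e′)
  where
  sp = coprimeSplit d e 1≤d
  open CoprimeSplit sp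
  d′≡1 : d′ ≡ 1
  d′≡1 = m^n≡1⇒m≡1 s 1≤s (∣1⇒≡1 (split-^-∣ s sp (subst (d ^ s ∣_) (sym (*-identityʳ _)) d^s∣e^s)))

-- The witness M = l * (g / gcd l g) is lcm(l, g).
lcm-^ : ∀ s {l g} → 1 ≤ l → 1 ≤ g →
        ∃[ M ] (1 ≤ M × (∀ x → l ^ s ∣ x → g ^ s ∣ x → M ^ s ∣ x) × (M ≤ g → l ∣ g))
lcm-^ s {l} {g} 1≤l 1≤g = l * g′ , *-mono-≤ 1≤l 1≤g′ , M^s∣ , M≤g⇒l∣g
  where
  sp = coprimeSplit l g 1≤l
  open CoprimeSplit sp using () renaming (g to t; d′ to l′; e′ to g′; d≡g*d′ to l≡t*l′; e≡g*e′ to g≡t*g′)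
  1≤g′ : 1 ≤ g′
  1≤g′ = 1≤m*n⇒1≤n {t} (subst (1 ≤_) g≡t*g′ 1≤g)
  M^s∣ : ∀ x → l ^ s ∣ x → g ^ s ∣ x → (l * g′) ^ s ∣ x
  M^s∣ x (divides q x≡q*l^s) g^s∣x = subst ((l * g′) ^ s ∣_) (sym x≡q*l^s)
    (subst (_∣ q * l ^ s) (sym (trans (^-distribʳ-* s l g′) (*-comm (l ^ s) (g′ ^ s)))) (*-monoˡ-∣ (l ^ s) g′^s∣q))
    where
    g^s∣l^sq : g ^ s ∣ l ^ s * q
    g^s∣l^sq = subst (g ^ s ∣_) (trans x≡q*l^s (*-comm q (l ^ s))) g^s∣x
    g′^s∣q : g′ ^ s ∣ q
    g′^s∣q = split-^-∣ s (swapSplit sp) g^s∣l^sq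
  M≤g⇒l∣g : l * g′ ≤ g → l ∣ g
  M≤g⇒l∣g M≤g = subst (_∣ g) (sym l≡t) (subst (t ∣_) (sym g≡t*g′) (m∣m*n g′))
    where
    l≤t : l ≤ t
    l≤t = *-cancelʳ-≤ l t g′ {{>-nonZero 1≤g′}} (subst (l * g′ ≤_) g≡t*g′ M≤g)
    t≤l : t ≤ l
    t≤l = subst (t ≤_) (sym l≡t*l′) (m≤m*n t l′ {{>-nonZero (1≤m*n⇒1≤n {t} (subst (1 ≤_) l≡t*l′ 1≤l))}})
    l≡t : l ≡ t
    l≡t = ≤-antisym l≤t t≤l

-- The s-th power gcd and reduced residues

powDividesAll-1 : ∀ s xs → PowDividesAll s xs 1
powDividesAll-1 s xs = All.tabulate (λ {x} _ → subst (_∣ ∣ x ∣) (sym (^-zeroˡ s)) (1∣ ∣ x ∣))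

largestPowFrom-spec : ∀ s xs l → ∃[ g ] (largestPowFrom s xs l ≡ g ^ s × 1 ≤ g × PowDividesAll s xs g ×
                        (∀ l′ → 1 ≤ l′ → l′ ≤ l → PowDividesAll s xs l′ → l′ ≤ g))
largestPowFrom-spec s xs zero =
  1 , sym (^-zeroˡ s) , ≤-refl , powDividesAll-1 s xs , λ l′ 1≤l′ l′≤0 _ → ⊥-elim (<-irrefl refl (≤-trans 1≤l′ l′≤0))
largestPowFrom-spec s xs (suc l) with all? (λ x → (suc l ^ s) ∣? ∣ x ∣) xs
... | yes all∣ = suc l , refl , s≤s z≤n , all∣ , λ _ _ l′≤1+l _ → l′≤1+l
... | no ¬all∣ with largestPowFrom-spec s xs l
... | g , eq , 1≤g , all∣ , largest = g , eq , 1≤g , all∣ , largest′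
  where
  largest′ : ∀ l′ → 1 ≤ l′ → l′ ≤ suc l → PowDividesAll s xs l′ → l′ ≤ g
  largest′ l′ 1≤l′ l′≤1+l all∣′ with m≤n⇒m<n∨m≡n l′≤1+l
  ... | inj₁ l′<1+l = largest l′ 1≤l′ (≤-pred l′<1+l) all∣′
  ... | inj₂ refl   = ⊥-elim (¬all∣ all∣′)

∣∣≤sum∣∣ : ∀ {x} xs → x ∈ xs → ∣ x ∣ ≤ foldr (λ y acc → ∣ y ∣ + acc) 0 xs
∣∣≤sum∣∣ (y ∷ xs) (here refl) = m≤m+n ∣ y ∣ _
∣∣≤sum∣∣ (y ∷ xs) (there x∈xs) = ≤-trans (∣∣≤sum∣∣ xs x∈xs) (m≤n+m _ ∣ y ∣)

record GcdₛRoot (s : ℕ) (xs : List ℤ) : Set where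
  field
    root        : ℕ
    1≤root      : 1 ≤ root
    gcdₛ≡root^s : gcdₛ s xs ≡ root ^ s
    ∣root       : ∀ l → 1 ≤ l → PowDividesAll s xs l → l ∣ root
    ∣root⇒      : ∀ l → l ∣ root → PowDividesAll s xs l

  root^s∣all : PowDividesAll s xs root
  root^s∣all = ∣root⇒ root ∣-refl

-- The search in gcdₛ returns the largest admissible l; any admissible l divides it because
-- lcm(l, root) is admissible as well.
gcdₛRoot : ∀ s xs {x} → 1 ≤ s → x ∈ xs → 1 ≤ ∣ x ∣ → GcdₛRoot s xs
gcdₛRoot s xs {x} 1≤s x∈xs 1≤∣x∣ with largestPowFrom-spec s xs (foldr (λ y acc → ∣ y ∣ + acc) 0 xs)
... | g , eq , 1≤g , g^s∣all , largest = record
  { root = g ; 1≤root = 1≤g ; gcdₛ≡root^s = eq ; ∣root = ∣g ; ∣root⇒ = ∣g⇒ }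
  where
  bounded : ∀ l → 1 ≤ l → PowDividesAll s xs l → l ≤ foldr (λ y acc → ∣ y ∣ + acc) 0 xs
  bounded l 1≤l l^s∣all = ≤-trans (m≤m^n s 1≤s 1≤l)
    (≤-trans (∣⇒≤ {{>-nonZero 1≤∣x∣}} (All.lookup l^s∣all x∈xs)) (∣∣≤sum∣∣ xs x∈xs))
  ∣g : ∀ l → 1 ≤ l → PowDividesAll s xs l → l ∣ g
  ∣g l 1≤l l^s∣all with lcm-^ s 1≤l 1≤g
  ... | M , 1≤M , M^s∣ , M≤g⇒l∣g = M≤g⇒l∣g (largest M 1≤M (bounded M 1≤M M^s∣all) M^s∣all)
    where
    M^s∣all = All.zipWith (λ { {y} (l^s∣y , g^s∣y) → M^s∣ ∣ y ∣ l^s∣y g^s∣y }) (l^s∣all , g^s∣all)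
  ∣g⇒ : ∀ l → l ∣ g → PowDividesAll s xs l
  ∣g⇒ l l∣g = All.map (∣-trans (^-pres-∣ s l∣g)) g^s∣all

prime≥2 : ∀ {p} → Prime p → 2 ≤ p
prime≥2 {p} p-prime = nonTrivial⇒n>1 p {{prime⇒nonTrivial p-prime}}

primeFactor : ∀ m → 2 ≤ m → ∃[ p ] (Prime p × p ∣ m)
primeFactor m 2≤m with factorise m {{>-nonZero (≤-trans (s≤s z≤n) 2≤m)}}
... | record { factors = [] ; isFactorisation = eq } = ⊥-elim (<-irrefl (sym eq) 2≤m)
... | record { factors = p ∷ ps ; isFactorisation = eq ; factorsPrime = p-prime ∷ _ } =
  p , p-prime , subst (p ∣_) (sym eq) (m∣m*n (product ps))

Reduced : ℕ → ℕ → ℤ → Set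
Reduced s N x = gcdₛ s (x ∷ ℤ.+ N ∷ []) ≡ 1

reduced? : ∀ s N x → Dec (Reduced s N x)
reduced? s N x = gcdₛ s (x ∷ ℤ.+ N ∷ []) ≟ 1

PrimePowerFree : ℕ → ℕ → ℤ → Set
PrimePowerFree s n x = ∀ p → Prime p → p ∣ n → ¬ (p ^ s ∣ ∣ x ∣)

module _ {s n} (x : ℤ) (1≤s : 1 ≤ s) (1≤n : 1 ≤ n) where

  gcdₛRootMod : GcdₛRoot s (x ∷ ℤ.+ (n ^ s) ∷ [])
  gcdₛRootMod = gcdₛRoot s _ 1≤s (there (here refl)) (1≤m^n s 1≤n)

  open GcdₛRoot gcdₛRootMod

  rootMod^s∣x : root ^ s ∣ ∣ x ∣
  rootMod^s∣x = All.head root^s∣all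

  rootMod∣n : root ∣ n
  rootMod∣n = ^∣^⇒∣ s 1≤s 1≤root (All.head (All.tail root^s∣all))

  reduced⇒primePowerFree : Reduced s (n ^ s) x → PrimePowerFree s n x
  reduced⇒primePowerFree reduced p p-prime p∣n p^s∣x = <-irrefl (sym p≡1) (prime≥2 p-prime)
    where
    p≡1 : p ≡ 1
    p≡1 = ∣1⇒≡1 (subst (p ∣_) (m^n≡1⇒m≡1 s 1≤s (trans (sym gcdₛ≡root^s) reduced))
            (∣root p (≤-trans (s≤s z≤n) (prime≥2 p-prime)) (p^s∣x ∷ ^-pres-∣ s p∣n ∷ [])))

  primePowerFree⇒reduced : PrimePowerFree s n x → Reduced s (n ^ s) x
  primePowerFree⇒reduced free with root ≟ 1
  ... | yes root≡1 = trans gcdₛ≡root^s (trans (cong (_^ s) root≡1) (^-zeroˡ s))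
  ... | no root≢1 with primeFactor root (≤∧≢⇒< 1≤root (root≢1 ∘ sym))
  ...   | p , p-prime , p∣root = ⊥-elim (free p p-prime (∣-trans p∣root rootMod∣n)
                                   (∣-trans (^-pres-∣ s p∣root) rootMod^s∣x))

reduced-1 : ∀ s n → 1 ≤ s → 1 ≤ n → Reduced s (n ^ s) (ℤ.+ 1)
reduced-1 s n 1≤s 1≤n = primePowerFree⇒reduced (ℤ.+ 1) 1≤s 1≤n λ p p-prime _ p^s∣1 →
  <-irrefl (sym (m^n≡1⇒m≡1 s 1≤s (∣1⇒≡1 p^s∣1))) (prime≥2 p-prime)

-- Reduced residues in a congruence class

infix 4 _∣ℤ_

_∣ℤ_ : ℕ → ℤ → Set
k ∣ℤ x = k ∣ ∣ x ∣

module _ {k : ℕ} where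

  ∣ℤ-+ : ∀ x y → k ∣ℤ x → k ∣ℤ y → k ∣ℤ (x ℤ.+ y)
  ∣ℤ-+ x y k∣x k∣y = ℤ.∣⇒∣ᵤ {ℤ.+ k} {x ℤ.+ y} (ℤ.∣m∣n⇒∣m+n (ℤ.∣ᵤ⇒∣ {ℤ.+ k} {x} k∣x) (ℤ.∣ᵤ⇒∣ {ℤ.+ k} {y} k∣y))

  ∣ℤ-- : ∀ x y → k ∣ℤ x → k ∣ℤ y → k ∣ℤ (x ℤ.- y)
  ∣ℤ-- x y k∣x k∣y = ℤ.∣⇒∣ᵤ {ℤ.+ k} {x ℤ.- y} (ℤ.∣m∣n⇒∣m-n (ℤ.∣ᵤ⇒∣ {ℤ.+ k} {x} k∣x) (ℤ.∣ᵤ⇒∣ {ℤ.+ k} {y} k∣y))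

  ∣ℤ-*ˡ : ∀ x y → k ∣ℤ y → k ∣ℤ (x ℤ.* y)
  ∣ℤ-*ˡ x y k∣y = ℤ.∣⇒∣ᵤ {ℤ.+ k} {x ℤ.* y} (ℤ.∣n⇒∣m*n x (ℤ.∣ᵤ⇒∣ {ℤ.+ k} {y} k∣y))

  ∣ℤ-neg : ∀ x → k ∣ℤ x → k ∣ℤ (ℤ.- x)
  ∣ℤ-neg x = subst (k ∣_) (sym (ℤ.∣-i∣≡∣i∣ x))

  ∣ℤ-cong : ∀ {x y} → x ≡ y → k ∣ℤ x → k ∣ℤ y
  ∣ℤ-cong refl k∣x = k∣x

  ¬∣ℤ-transfer : ∀ x y → k ∣ℤ (y ℤ.- x) → ¬ k ∣ℤ x → ¬ k ∣ℤ y
  ¬∣ℤ-transfer x y k∣y-x k∤x k∣y = k∤x (∣ℤ-cong (y-[y-x]≡x y x) (∣ℤ-- y (y ℤ.- x) k∣y k∣y-x))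
    where
    y-[y-x]≡x : ∀ y x → y ℤ.- (y ℤ.- x) ≡ x
    y-[y-x]≡x = ℤ.solve-∀

module _ (N : ℕ) (G : ℤ → ℕ) (periodic : ∀ x → G (x ℤ.+ ℤ.+ N) ≡ G x) where

  private
    window : ℤ → ℕ
    window t = ∑[ i < N ] G (ℤ.+ suc i ℤ.+ t)

    -- The window starting one step later loses G (1 + t) and gains G (N + 1 + t), which agree.
    window-step : ∀ t → window (t ℤ.+ ℤ.+ 1) ≡ window t
    window-step t = +-cancelˡ-≡ (f 1) _ _ (begin
      f 1 + window (t ℤ.+ ℤ.+ 1)    ≡⟨ cong (f 1 +_) (∑<-cong N (λ i _ → cong G (shift (ℤ.+ suc i) t))) ⟩
      f 1 + ∑[ i < N ] f (2 + i)    ≡⟨ sym (∑<-suc N (f ∘ suc)) ⟩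
      ∑[ i < suc N ] f (suc i)      ≡⟨ cong (window t +_) (trans (cong G (wrap t)) (periodic (ℤ.+ 1 ℤ.+ t))) ⟩
      window t + f 1                ≡⟨ +-comm (window t) (f 1) ⟩
      f 1 + window t                ∎)
      where
      open ≡-Reasoning
      f : ℕ → ℕ
      f i = G (ℤ.+ i ℤ.+ t)
      shift : ∀ i t → i ℤ.+ (t ℤ.+ ℤ.+ 1) ≡ (ℤ.+ 1 ℤ.+ i) ℤ.+ t
      shift = ℤ.solve-∀
      wrap : ∀ t → ℤ.+ suc N ℤ.+ t ≡ (ℤ.+ 1 ℤ.+ t) ℤ.+ ℤ.+ N
      wrap t = trans (cong (ℤ._+ t) (ℤ.pos-+ 1 N)) (rearrange (ℤ.+ 1) (ℤ.+ N) t)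
        where
        rearrange : ∀ a b c → (a ℤ.+ b) ℤ.+ c ≡ (a ℤ.+ c) ℤ.+ b
        rearrange = ℤ.solve-∀

    window-const : ∀ t → window t ≡ window (ℤ.+ 0)
    window-const (ℤ.+ zero)   = refl
    window-const (ℤ.+ suc a)  = trans (cong window (cong ℤ.+_ (+-comm 1 a))) (trans (window-step (ℤ.+ a)) (window-const (ℤ.+ a)))
    window-const -[1+ zero ]  = sym (window-step -[1+ zero ])
    window-const -[1+ suc b ] = trans (sym (window-step -[1+ suc b ])) (window-const -[1+ b ])

  ∑<-periodic-shift : ∀ t → ∑[ i < N ] G (ℤ.+ suc i ℤ.+ t) ≡ ∑[ i < N ] G (ℤ.+ suc i)
  ∑<-periodic-shift t = trans (window-const t) (∑<-cong N (λ i _ → cong G (ℤ.+-identityʳ (ℤ.+ suc i))))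

∑<-divides-once : ∀ D x → 1 ≤ D → ∑[ j < D ] 𝟙 (D ∣? ∣ x ℤ.- ℤ.+ suc j ∣) ≡ 1
∑<-divides-once D x 1≤D = begin
  ∑[ j < D ] 𝟙 (D ∣? ∣ x ℤ.- ℤ.+ suc j ∣)  ≡⟨ ∑<-cong D (λ j _ → cong (λ z → 𝟙 (D ∣? z)) (∣x-y∣≡∣y-x∣ (ℤ.+ suc j))) ⟩
  ∑[ j < D ] G (ℤ.+ suc j ℤ.+ ℤ.- x)       ≡⟨ ∑<-periodic-shift D G periodic (ℤ.- x) ⟩
  ∑[ j < D ] 𝟙 (D ∣? suc j)                ≡⟨ onlyLast D 1≤D ⟩
  1                                        ∎
  where
  open ≡-Reasoning
  G : ℤ → ℕ
  G y = 𝟙 (D ∣? ∣ y ∣)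
  periodic : ∀ y → G (y ℤ.+ ℤ.+ D) ≡ G y
  periodic y = 𝟙-cong (λ D∣y+D → ∣ℤ-cong (y+D-D≡y y (ℤ.+ D)) (∣ℤ-- (y ℤ.+ ℤ.+ D) (ℤ.+ D) D∣y+D ∣-refl))
                      (λ D∣y → ∣ℤ-+ y (ℤ.+ D) D∣y ∣-refl) (D ∣? ∣ y ℤ.+ ℤ.+ D ∣) (D ∣? ∣ y ∣)
    where
    y+D-D≡y : ∀ y e → y ℤ.+ e ℤ.- e ≡ y
    y+D-D≡y = ℤ.solve-∀
  ∣x-y∣≡∣y-x∣ : ∀ y → ∣ x ℤ.- y ∣ ≡ ∣ y ℤ.+ ℤ.- x ∣
  ∣x-y∣≡∣y-x∣ y = trans (cong ∣_∣ (negate y x)) (ℤ.∣-i∣≡∣i∣ (y ℤ.+ ℤ.- x))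
    where
    negate : ∀ y x → x ℤ.- y ≡ ℤ.- (y ℤ.+ ℤ.- x)
    negate = ℤ.solve-∀
  onlyLast : ∀ D → 1 ≤ D → ∑[ j < D ] 𝟙 (D ∣? suc j) ≡ 1
  onlyLast (suc D) _ = ∑<-𝟙-unique (suc D) D (λ j → suc D ∣? suc j) ≤-refl ∣-refl
    (λ j j<1+D 1+D∣1+j → suc-injective (≤-antisym j<1+D (∣⇒≤ 1+D∣1+j)))

-- Divides out gcd x d until x is coprime to d; x shrinks at each step, so fuel ≥ x suffices.
coprimePart : (d fuel x : ℕ) → ℕ
coprimePart d zero       x = x
coprimePart d (suc fuel) x with gcd x d ≟ 1
... | yes _ = x
... | no _  = coprimePart d fuel (quotient (gcd[m,n]∣m x d))

module _ (d x : ℕ) (1≤x : 1 ≤ x) (gcd≢1 : gcd x d ≢ 1) where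

  private
    q = quotient (gcd[m,n]∣m x d)
    x≡q*gcd : x ≡ q * gcd x d
    x≡q*gcd = m∣n⇒n≡quotient*m (gcd[m,n]∣m x d)

  1≤x/gcd : 1 ≤ q
  1≤x/gcd = 1≤m*n⇒1≤m (subst (1 ≤_) x≡q*gcd 1≤x)

  x/gcd<x : q < x
  x/gcd<x = subst (q <_) (sym x≡q*gcd) (subst (_< q * gcd x d) (*-identityʳ q)
              (*-monoʳ-< q {{>-nonZero 1≤x/gcd}} (≤∧≢⇒< 1≤gcd (gcd≢1 ∘ sym))))
    where
    1≤gcd : 1 ≤ gcd x d
    1≤gcd = 1≤m*n⇒1≤n {q} (subst (1 ≤_) x≡q*gcd 1≤x)

  prime∣x/gcd : ∀ p → Prime p → p ∣ x → ¬ p ∣ d → p ∣ q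
  prime∣x/gcd p p-prime p∣x p∤d with euclidsLemma q (gcd x d) p-prime (subst (p ∣_) x≡q*gcd p∣x)
  ... | inj₁ p∣q   = p∣q
  ... | inj₂ p∣gcd = ⊥-elim (p∤d (∣-trans p∣gcd (gcd[m,n]∣n x d)))

coprimePart-spec : ∀ d fuel x → 1 ≤ x → x ≤ fuel →
  1 ≤ coprimePart d fuel x × Coprime (coprimePart d fuel x) d ×
  (∀ p → Prime p → p ∣ x → ¬ p ∣ d → p ∣ coprimePart d fuel x)
coprimePart-spec d zero       x 1≤x x≤0 = ⊥-elim (<-irrefl refl (≤-trans 1≤x x≤0))
coprimePart-spec d (suc fuel) x 1≤x x≤1+fuel with gcd x d ≟ 1
... | yes gcd≡1 = 1≤x , gcd≡1⇒coprime gcd≡1 , λ _ _ p∣x _ → p∣x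
... | no gcd≢1 with coprimePart-spec d fuel _ (1≤x/gcd d x 1≤x gcd≢1) (≤-pred (≤-trans (x/gcd<x d x 1≤x gcd≢1) x≤1+fuel))
...   | 1≤e , e⊥d , prime∣e = 1≤e , e⊥d , λ p p-prime p∣x p∤d →
          prime∣e p p-prime (prime∣x/gcd d x 1≤x gcd≢1 p p-prime p∣x p∤d) p∤d

Φ≡∑< : ∀ s M → Φ s M ≡ ∑[ i < M ] 𝟙 (reduced? s M (ℤ.+ suc i))
Φ≡∑< s M = trans (length-filter _ (range1 M)) (∑-range1 M _)

module ResidueClasses {s n d : ℕ} (1≤s : 1 ≤ s) (1≤n : 1 ≤ n) (1≤d : 1 ≤ d) (d∣n : d ∣ n) where

  N : ℕ
  N = n ^ s

  D : ℕ
  D = d ^ s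

  InClass : ℤ → ℤ → Set
  InClass a x = Reduced s N x × D ∣ℤ (x ℤ.- a)

  inClass? : ∀ a x → Dec (InClass a x)
  inClass? a x = reduced? s N x ×-dec (D ∣? ∣ x ℤ.- a ∣)

  reduced⇒primePowerFreeᵈ : ∀ x → Reduced s N x → PrimePowerFree s d x
  reduced⇒primePowerFreeᵈ x x-reduced p p-prime p∣d =
    reduced⇒primePowerFree x 1≤s 1≤n x-reduced p p-prime (∣-trans p∣d d∣n)

  -- Modulo the primes of d the class is fixed by the congruence mod D; the other primes of n do
  -- not see the shift v - u.
  inClass-transfer : ∀ u v a a′ → D ∣ℤ ((v ℤ.- a′) ℤ.- (u ℤ.- a)) →
                     (∀ p → Prime p → p ∣ n → ¬ p ∣ d → p ^ s ∣ℤ (v ℤ.- u)) →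
                     PrimePowerFree s d a′ → InClass a u → InClass a′ v
  inClass-transfer u v a a′ D∣ shift a′-free (u-reduced , D∣u-a) = v-reduced , D∣v-a′
    where
    D∣v-a′ : D ∣ℤ (v ℤ.- a′)
    D∣v-a′ = ∣ℤ-cong (regroup (v ℤ.- a′) (u ℤ.- a)) (∣ℤ-+ ((v ℤ.- a′) ℤ.- (u ℤ.- a)) (u ℤ.- a) D∣ D∣u-a)
      where
      regroup : ∀ x y → (x ℤ.- y) ℤ.+ y ≡ x
      regroup = ℤ.solve-∀
    v-free : PrimePowerFree s n v
    v-free p p-prime p∣n with p ∣? d
    ... | yes p∣d = ¬∣ℤ-transfer a′ v (∣-trans (^-pres-∣ s p∣d) D∣v-a′) (a′-free p p-prime p∣d)
    ... | no p∤d  = ¬∣ℤ-transfer u v (shift p p-prime p∣n p∤d)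
                      (reduced⇒primePowerFree u 1≤s 1≤n u-reduced p p-prime p∣n)
    v-reduced = primePowerFree⇒reduced v 1≤s 1≤n v-free

  D∣N : D ∣ N
  D∣N = ^-pres-∣ s d∣n

  inClass-periodic : ∀ a → PrimePowerFree s d a → ∀ x → 𝟙 (inClass? a (x ℤ.+ ℤ.+ N)) ≡ 𝟙 (inClass? a x)
  inClass-periodic a a-free x = 𝟙-cong
    (inClass-transfer (x ℤ.+ ℤ.+ N) x a a
      (∣ℤ-cong (sym (back x a (ℤ.+ N))) (∣ℤ-neg (ℤ.+ N) D∣N))
      (λ p _ p∣n _ → ∣ℤ-cong (sym (back′ x (ℤ.+ N))) (∣ℤ-neg (ℤ.+ N) (^-pres-∣ s p∣n))) a-free)
    (inClass-transfer x (x ℤ.+ ℤ.+ N) a a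
      (∣ℤ-cong (sym (forth x a (ℤ.+ N))) D∣N)
      (λ p _ p∣n _ → ∣ℤ-cong (sym (forth′ x (ℤ.+ N))) (^-pres-∣ s p∣n)) a-free)
    (inClass? a (x ℤ.+ ℤ.+ N)) (inClass? a x)
    where
    back : ∀ x a y → (x ℤ.- a) ℤ.- ((x ℤ.+ y) ℤ.- a) ≡ ℤ.- y
    back = ℤ.solve-∀
    back′ : ∀ x y → x ℤ.- (x ℤ.+ y) ≡ ℤ.- y
    back′ = ℤ.solve-∀
    forth : ∀ x a y → ((x ℤ.+ y) ℤ.- a) ℤ.- (x ℤ.- a) ≡ y
    forth = ℤ.solve-∀
    forth′ : ∀ x y → (x ℤ.+ y) ℤ.- x ≡ y
    forth′ = ℤ.solve-∀

  W : ℕ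
  W = coprimePart d n n ^ s

  W⊥D : Coprime W D
  W⊥D = coprime-^ s (proj₁ (proj₂ (coprimePart-spec d n n 1≤n ≤-refl)))

  p^s∣W : ∀ p → Prime p → p ∣ n → ¬ p ∣ d → p ^ s ∣ W
  p^s∣W p p-prime p∣n p∤d = ^-pres-∣ s (proj₂ (proj₂ (coprimePart-spec d n n 1≤n ≤-refl)) p p-prime p∣n p∤d)

  crtLift : ∀ c → ∃[ t ] (D ∣ℤ (t ℤ.- c) × W ∣ℤ t)
  crtLift c with coprime-Bézout W⊥D
  ... | Bézout.+- x y 1+yD≡xW =
    c ℤ.* ℤ.+ (x * W) ,
    ∣ℤ-cong (sym (trans (cong (λ z → c ℤ.* ℤ.+ z ℤ.- c) (sym 1+yD≡xW)) (lemma c (ℤ.+ (y * D)))))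
      (∣ℤ-*ˡ c (ℤ.+ (y * D)) (n∣m*n y)) ,
    ∣ℤ-*ˡ c (ℤ.+ (x * W)) (n∣m*n x)
    where
    lemma : ∀ c z → c ℤ.* (ℤ.+ 1 ℤ.+ z) ℤ.- c ≡ c ℤ.* z
    lemma = ℤ.solve-∀
  ... | Bézout.-+ x y 1+xW≡yD =
    ℤ.- (c ℤ.* ℤ.+ (x * W)) ,
    ∣ℤ-cong (sym (trans (lemma c (ℤ.+ (x * W))) (cong (λ z → ℤ.- (c ℤ.* ℤ.+ z)) 1+xW≡yD)))
      (∣ℤ-neg (c ℤ.* ℤ.+ (y * D)) (∣ℤ-*ˡ c (ℤ.+ (y * D)) (n∣m*n y))) ,
    ∣ℤ-neg (c ℤ.* ℤ.+ (x * W)) (∣ℤ-*ˡ c (ℤ.+ (x * W)) (n∣m*n x))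
    where
    lemma : ∀ c z → ℤ.- (c ℤ.* z) ℤ.- c ≡ ℤ.- (c ℤ.* (ℤ.+ 1 ℤ.+ z))
    lemma = ℤ.solve-∀

  classCount : ℤ → ℕ
  classCount a = ∑[ i < N ] 𝟙 (inClass? a (ℤ.+ suc i))

  -- Translating by a lift t of a - a′ maps the class of a′ onto the class of a.
  classCount-independent : ∀ a a′ → PrimePowerFree s d a → PrimePowerFree s d a′ → classCount a ≡ classCount a′
  classCount-independent a a′ a-free a′-free =
    trans (sym (∑<-periodic-shift N (𝟙 ∘ inClass? a) (inClass-periodic a a-free) t))
          (∑<-cong N (λ i _ → translate (ℤ.+ suc i)))
    where
    t = proj₁ (crtLift (a ℤ.- a′))
    D∣t-[a-a′] = proj₁ (proj₂ (crtLift (a ℤ.- a′)))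
    W∣t = proj₂ (proj₂ (crtLift (a ℤ.- a′)))
    p^s∣t : ∀ p → Prime p → p ∣ n → ¬ p ∣ d → p ^ s ∣ℤ t
    p^s∣t p p-prime p∣n p∤d = ∣-trans (p^s∣W p p-prime p∣n p∤d) W∣t
    back : ∀ x t a a′ → (x ℤ.- a′) ℤ.- ((x ℤ.+ t) ℤ.- a) ≡ ℤ.- (t ℤ.- (a ℤ.- a′))
    back = ℤ.solve-∀
    back′ : ∀ x t → x ℤ.- (x ℤ.+ t) ≡ ℤ.- t
    back′ = ℤ.solve-∀
    forth : ∀ x t a a′ → ((x ℤ.+ t) ℤ.- a) ℤ.- (x ℤ.- a′) ≡ t ℤ.- (a ℤ.- a′)
    forth = ℤ.solve-∀
    forth′ : ∀ x t → (x ℤ.+ t) ℤ.- x ≡ t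
    forth′ = ℤ.solve-∀
    translate : ∀ x → 𝟙 (inClass? a (x ℤ.+ t)) ≡ 𝟙 (inClass? a′ x)
    translate x = 𝟙-cong
      (inClass-transfer (x ℤ.+ t) x a a′
        (∣ℤ-cong (sym (back x t a a′)) (∣ℤ-neg (t ℤ.- (a ℤ.- a′)) D∣t-[a-a′]))
        (λ p p-prime p∣n p∤d → ∣ℤ-cong (sym (back′ x t)) (∣ℤ-neg t (p^s∣t p p-prime p∣n p∤d))) a′-free)
      (inClass-transfer x (x ℤ.+ t) a′ a
        (∣ℤ-cong (sym (forth x t a a′)) D∣t-[a-a′])
        (λ p p-prime p∣n p∤d → ∣ℤ-cong (sym (forth′ x t)) (p^s∣t p p-prime p∣n p∤d)) a-free)
      (inClass? a (x ℤ.+ t)) (inClass? a′ x)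

  residueCount : ℤ → ℕ
  residueCount a = ∑[ m ∈ reducedₛ s N ] 𝟙 (D ∣? ∣ ℤ.+ m ℤ.- a ∣)

  residueCount≡classCount : ∀ a → residueCount a ≡ classCount a
  residueCount≡classCount a = trans (∑-filter _ (range1 N) _) (trans (∑-range1 N _)
    (∑<-cong N (λ i _ → sym (𝟙-× (reduced? s N (ℤ.+ suc i)) (D ∣? ∣ ℤ.+ suc i ℤ.- a ∣)))))

  uniqueResidue : ∀ x → Reduced s N x →
                  ∑[ j < D ] 𝟙 (reduced? s D (ℤ.+ suc j) ×-dec (D ∣? ∣ x ℤ.- ℤ.+ suc j ∣)) ≡ 1
  uniqueResidue x x-reduced = trans
    (∑<-cong D (λ j _ → 𝟙-cong proj₂ (λ D∣x-j → reducedᴰ j D∣x-j , D∣x-j) (reduced? s D (ℤ.+ suc j) ×-dec _) _))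
    (∑<-divides-once D x (1≤m^n s 1≤d))
    where
    flip : ∀ x y → ℤ.- (x ℤ.- y) ≡ y ℤ.- x
    flip = ℤ.solve-∀
    reducedᴰ : ∀ j → D ∣ℤ (x ℤ.- ℤ.+ suc j) → Reduced s D (ℤ.+ suc j)
    reducedᴰ j D∣x-j = primePowerFree⇒reduced (ℤ.+ suc j) 1≤s 1≤d λ p p-prime p∣d →
      ¬∣ℤ-transfer x (ℤ.+ suc j)
        (∣ℤ-cong (flip x (ℤ.+ suc j)) (∣ℤ-neg (x ℤ.- ℤ.+ suc j) (∣-trans (^-pres-∣ s p∣d) D∣x-j)))
        (reduced⇒primePowerFreeᵈ x x-reduced p p-prime p∣d)

  Φ≡residueCount*Φ : ∀ a → PrimePowerFree s d a → Φ s N ≡ residueCount a * Φ s D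
  Φ≡residueCount*Φ a a-free = begin
    Φ s N                                      ≡⟨ Φ≡∑< s N ⟩
    ∑[ i < N ] r i                             ≡⟨ ∑<-cong N (λ i _ → fibre i) ⟩
    ∑[ i < N ] (r i * ∑[ j < D ] c i j)        ≡⟨ ∑<-cong N (λ i _ → sym (∑<-*ˡ D (r i) (c i))) ⟩
    ∑[ i < N ] ∑[ j < D ] (r i * c i j)        ≡⟨ ∑<-swap N D (λ i j → r i * c i j) ⟩
    ∑[ j < D ] ∑[ i < N ] (r i * c i j)        ≡⟨ ∑<-cong D (λ j _ → over j) ⟩
    ∑[ j < D ] (ρ j * classCount (ℤ.+ suc j))  ≡⟨ ∑<-cong D (λ j _ → sameSize j) ⟩
    ∑[ j < D ] (ρ j * classCount a)            ≡⟨ ∑<-*ʳ D (classCount a) ρ ⟩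
    ∑[ j < D ] ρ j * classCount a              ≡⟨ cong₂ _*_ (sym (Φ≡∑< s D)) (sym (residueCount≡classCount a)) ⟩
    Φ s D * residueCount a                     ≡⟨ *-comm (Φ s D) (residueCount a) ⟩
    residueCount a * Φ s D                     ∎
    where
    open ≡-Reasoning
    r ρ : ℕ → ℕ
    r i = 𝟙 (reduced? s N (ℤ.+ suc i))
    ρ j = 𝟙 (reduced? s D (ℤ.+ suc j))
    congruent? : ∀ i j → Dec (D ∣ℤ (ℤ.+ suc i ℤ.- ℤ.+ suc j))
    congruent? i j = D ∣? ∣ ℤ.+ suc i ℤ.- ℤ.+ suc j ∣
    c : ℕ → ℕ → ℕ
    c i j = 𝟙 (reduced? s D (ℤ.+ suc j) ×-dec congruent? i j)
    fibre : ∀ i → r i ≡ r i * ∑[ j < D ] c i j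
    fibre i = trans (sym (*-identityʳ (r i)))
      (𝟙-*-cong (reduced? s N (ℤ.+ suc i)) (λ i-reduced → sym (uniqueResidue (ℤ.+ suc i) i-reduced)))
    sameSize : ∀ j → ρ j * classCount (ℤ.+ suc j) ≡ ρ j * classCount a
    sameSize j = 𝟙-*-cong (reduced? s D (ℤ.+ suc j)) λ j-reduced →
      classCount-independent (ℤ.+ suc j) a (reduced⇒primePowerFree (ℤ.+ suc j) 1≤s 1≤d j-reduced) a-free
    over : ∀ j → ∑[ i < N ] (r i * c i j) ≡ ρ j * classCount (ℤ.+ suc j)
    over j = trans (∑<-cong N (λ i _ → begin
        r i * c i j                                 ≡⟨ cong (r i *_) (𝟙-× (reduced? s D (ℤ.+ suc j)) (congruent? i j)) ⟩
        r i * (ρ j * 𝟙 (congruent? i j))            ≡⟨ swap (r i) (ρ j) _ ⟩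
        ρ j * (r i * 𝟙 (congruent? i j))            ≡⟨ cong (ρ j *_) (sym (𝟙-× (reduced? s N (ℤ.+ suc i)) (congruent? i j))) ⟩
        ρ j * 𝟙 (inClass? (ℤ.+ suc j) (ℤ.+ suc i))  ∎))
      (∑<-*ˡ N (ρ j) (λ i → 𝟙 (inClass? (ℤ.+ suc j) (ℤ.+ suc i))))
      where
      swap : ∀ a b c → a * (b * c) ≡ b * (a * c)
      swap a b c = trans (sym (*-assoc a b c)) (trans (cong (_* c) (*-comm a b)) (*-assoc b a c))

-- A Jordan-type identity

∑<-multiples : ∀ K M (f : ℕ → ℕ) → 1 ≤ K → (∀ x → ¬ K ∣ x → f x ≡ 0) →
               ∑[ i < K * M ] f (suc i) ≡ ∑[ i < M ] f (K * suc i)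
∑<-multiples K zero    f _ _ rewrite *-zeroʳ K = refl
∑<-multiples (suc K) (suc M) f 1≤K vanishes = begin
  ∑[ i < K′ * suc M ] f (suc i)
    ≡⟨ cong (λ L → ∑[ i < L ] f (suc i)) (trans (*-suc K′ M) (+-comm K′ _)) ⟩
  ∑[ i < K′ * M + K′ ] f (suc i)
    ≡⟨ ∑<-+ (K′ * M) K′ _ ⟩
  ∑[ i < K′ * M ] f (suc i) + ∑[ i < K′ ] f (suc (K′ * M + i))
    ≡⟨ cong₂ _+_ (∑<-multiples K′ M f 1≤K vanishes) lastBlock ⟩
  ∑[ i < M ] f (K′ * suc i) + f (K′ * suc M)
    ∎
  where
  open ≡-Reasoning
  K′ = suc K
  lastBlock : ∑[ i < K′ ] f (suc (K′ * M + i)) ≡ f (K′ * suc M)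
  lastBlock = cong₂ _+_
    (∑<-zero K _ λ i i<K → vanishes _ λ K′∣ → <-irrefl refl (≤-trans (s≤s i<K)
      (∣⇒≤ (∣m+n∣m⇒∣n (subst (K′ ∣_) (sym (+-suc (K′ * M) i)) K′∣) (m∣m*n M)))))
    (cong f (trans (sym (+-suc (K′ * M) K)) (trans (+-comm (K′ * M) K′) (sym (*-suc K′ M)))))

-- With roots L and R of the two sides, c R is admissible on the left, and splitting L against c shows
-- that L / gcd(L, c) is admissible on the right; hence L = c R.
gcdₛ-homogeneous : ∀ s c d m → 1 ≤ s → 1 ≤ c → 1 ≤ d →
  gcdₛ s (ℤ.+ (c ^ s * m) ∷ ℤ.+ ((c * d) ^ s) ∷ []) ≡ c ^ s * gcdₛ s (ℤ.+ m ∷ ℤ.+ (d ^ s) ∷ [])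
gcdₛ-homogeneous s c d m 1≤s 1≤c 1≤d = begin
  gcdₛ s (ℤ.+ (c ^ s * m) ∷ ℤ.+ ((c * d) ^ s) ∷ [])  ≡⟨ L.gcdₛ≡root^s ⟩
  L.root ^ s                                        ≡⟨ cong (_^ s) (∣-antisym L∣cR cR∣L) ⟩
  (c * R.root) ^ s                                  ≡⟨ ^-distribʳ-* s c R.root ⟩
  c ^ s * R.root ^ s                                ≡⟨ cong (c ^ s *_) (sym R.gcdₛ≡root^s) ⟩
  c ^ s * gcdₛ s (ℤ.+ m ∷ ℤ.+ (d ^ s) ∷ [])          ∎
  where
  open ≡-Reasoning
  module L = GcdₛRoot (gcdₛRootMod (ℤ.+ (c ^ s * m)) 1≤s (*-mono-≤ 1≤c 1≤d))
  module R = GcdₛRoot (gcdₛRootMod (ℤ.+ m) 1≤s 1≤d)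
  cR∣L : c * R.root ∣ L.root
  cR∣L = L.∣root (c * R.root) (*-mono-≤ 1≤c R.1≤root)
    ( subst (_∣ c ^ s * m) (sym (^-distribʳ-* s c R.root)) (*-monoʳ-∣ (c ^ s) (rootMod^s∣x (ℤ.+ m) 1≤s 1≤d))
    ∷ ^-pres-∣ s (*-monoʳ-∣ c (rootMod∣n (ℤ.+ m) 1≤s 1≤d))
    ∷ [])
  sp = coprimeSplit L.root c L.1≤root
  open CoprimeSplit sp
  L′∣R : d′ ∣ R.root
  L′∣R = R.∣root d′ (1≤m*n⇒1≤n {g} (subst (1 ≤_) d≡g*d′ L.1≤root))
    ( split-^-∣ s sp (rootMod^s∣x (ℤ.+ (c ^ s * m)) 1≤s (*-mono-≤ 1≤c 1≤d))
    ∷ split-^-∣ s sp (subst (L.root ^ s ∣_) (^-distribʳ-* s c d) (^-pres-∣ s (rootMod∣n (ℤ.+ (c ^ s * m)) 1≤s (*-mono-≤ 1≤c 1≤d))))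
    ∷ [])
  L∣cR : L.root ∣ c * R.root
  L∣cR = subst₂ _∣_ (sym d≡g*d′) refl (*-pres-∣ (subst (g ∣_) (sym e≡g*e′) (m∣m*n e′)) L′∣R)

-- HasCofactor s e x j says (x, e ^ s)_s = (e / j) ^ s, stated without division.
HasCofactor : ℕ → ℕ → ℕ → ℕ → Set
HasCofactor s e x j = gcdₛ s (ℤ.+ x ∷ ℤ.+ (e ^ s) ∷ []) * j ^ s ≡ e ^ s

hasCofactor? : ∀ s e x j → Dec (HasCofactor s e x j)
hasCofactor? s e x j = gcdₛ s (ℤ.+ x ∷ ℤ.+ (e ^ s) ∷ []) * j ^ s ≟ e ^ s

-- The x with cofactor d are the multiples c ^ s x′ with (x′, d ^ s)_s = 1.
count-hasCofactor : ∀ s c d → 1 ≤ s → 1 ≤ c → 1 ≤ d →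
  ∑[ i < (c * d) ^ s ] 𝟙 (hasCofactor? s (c * d) (suc i) d) ≡ Φ s (d ^ s)
count-hasCofactor s c d 1≤s 1≤c 1≤d = begin
  ∑[ i < E ] f (suc i)                               ≡⟨ cong (λ L → ∑[ i < L ] f (suc i)) (^-distribʳ-* s c d) ⟩
  ∑[ i < c ^ s * d ^ s ] f (suc i)                   ≡⟨ ∑<-multiples (c ^ s) (d ^ s) f (1≤m^n s 1≤c) off-multiples ⟩
  ∑[ i < d ^ s ] f (c ^ s * suc i)                   ≡⟨ ∑<-cong (d ^ s) (λ i _ → on-multiples i) ⟩
  ∑[ i < d ^ s ] 𝟙 (reduced? s (d ^ s) (ℤ.+ suc i))  ≡⟨ sym (Φ≡∑< s (d ^ s)) ⟩
  Φ s (d ^ s)                                        ∎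
  where
  open ≡-Reasoning
  E = (c * d) ^ s
  f : ℕ → ℕ
  f x = 𝟙 (hasCofactor? s (c * d) x d)
  cancel-d^s : ∀ {a} → a * d ^ s ≡ E → a ≡ c ^ s
  cancel-d^s {a} eq = *-cancelʳ-≡ a (c ^ s) (d ^ s) {{>-nonZero (1≤m^n s 1≤d)}} (trans eq (^-distribʳ-* s c d))
  off-multiples : ∀ x → ¬ c ^ s ∣ x → f x ≡ 0
  off-multiples x c^s∤x = 𝟙-no (hasCofactor? s (c * d) x d) λ eq →
    c^s∤x (subst (λ r → r ^ s ∣ x) (^-injectiveˡ s 1≤s (trans (sym X.gcdₛ≡root^s) (cancel-d^s eq)))
      (rootMod^s∣x (ℤ.+ x) 1≤s (*-mono-≤ 1≤c 1≤d)))
    where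
    module X = GcdₛRoot (gcdₛRootMod (ℤ.+ x) 1≤s (*-mono-≤ 1≤c 1≤d))
  on-multiples : ∀ i → f (c ^ s * suc i) ≡ 𝟙 (reduced? s (d ^ s) (ℤ.+ suc i))
  on-multiples i = 𝟙-cong
    (λ eq → *-cancelˡ-≡ _ 1 (c ^ s) {{>-nonZero (1≤m^n s 1≤c)}}
              (trans (sym homogeneous) (trans (cancel-d^s eq) (sym (*-identityʳ _)))))
    (λ reduced → trans (cong (_* d ^ s) (trans homogeneous (trans (cong (c ^ s *_) reduced) (*-identityʳ (c ^ s)))))
                       (sym (^-distribʳ-* s c d)))
    (hasCofactor? s (c * d) (c ^ s * suc i) d) (reduced? s (d ^ s) (ℤ.+ suc i))
    where
    homogeneous = gcdₛ-homogeneous s c d (suc i) 1≤s 1≤c 1≤d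

-- The cofactor of x is e / root, where root ^ s = (x, e ^ s)_s.
cofactor-unique : ∀ s e B x → 1 ≤ s → 1 ≤ e → e ≤ B →
  ∑[ j < B ] 𝟙 ((suc j ∣? e) ×-dec hasCofactor? s e x (suc j)) ≡ 1
cofactor-unique s e B x 1≤s 1≤e e≤B =
  ∑<-𝟙-unique B (pred q) (λ j → (suc j ∣? e) ×-dec hasCofactor? s e x (suc j)) q-1<B
    (subst (_∣ e) (sym 1+[q-1]≡q) q∣e , cofactor) unique
  where
  module G = GcdₛRoot (gcdₛRootMod (ℤ.+ x) 1≤s 1≤e)
  root∣e = rootMod∣n (ℤ.+ x) 1≤s 1≤e
  q = quotient root∣e
  e≡q*root : e ≡ q * G.root
  e≡q*root = m∣n⇒n≡quotient*m root∣e
  1+[q-1]≡q : suc (pred q) ≡ q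
  1+[q-1]≡q = suc-pred q {{>-nonZero (1≤m*n⇒1≤m (subst (1 ≤_) e≡q*root 1≤e))}}
  q∣e : q ∣ e
  q∣e = subst (q ∣_) (sym e≡q*root) (m∣m*n G.root)
  q-1<B : pred q < B
  q-1<B = ≤-trans (subst (_≤ e) (sym 1+[q-1]≡q) (∣⇒≤ {{>-nonZero 1≤e}} q∣e)) e≤B
  cofactor : HasCofactor s e x (suc (pred q))
  cofactor = trans (cong₂ (λ a b → a * b ^ s) G.gcdₛ≡root^s 1+[q-1]≡q)
    (trans (sym (^-distribʳ-* s G.root q)) (cong (_^ s) (trans (*-comm G.root q) (sym e≡q*root))))
  unique : ∀ j → j < B → suc j ∣ e × HasCofactor s e x (suc j) → j ≡ pred q
  unique j _ (_ , eq) = suc-injective (trans 1+j≡q (sym 1+[q-1]≡q))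
    where
    root*[1+j]≡e : G.root * suc j ≡ e
    root*[1+j]≡e = ^-injectiveˡ s 1≤s
      (trans (^-distribʳ-* s G.root (suc j)) (trans (cong (_* suc j ^ s) (sym G.gcdₛ≡root^s)) eq))
    1+j≡q : suc j ≡ q
    1+j≡q = *-cancelʳ-≡ (suc j) q G.root {{>-nonZero G.1≤root}}
      (trans (*-comm (suc j) G.root) (trans root*[1+j]≡e e≡q*root))

cofactor-count : ∀ s e j → 1 ≤ s → 1 ≤ e →
  ∑[ i < e ^ s ] 𝟙 ((suc j ∣? e) ×-dec hasCofactor? s e (suc i) (suc j)) ≡ 𝟙 (suc j ∣? e) * Φ s (suc j ^ s)
cofactor-count s e j 1≤s 1≤e = begin
  ∑[ i < e ^ s ] 𝟙 ((suc j ∣? e) ×-dec cofactor? i)    ≡⟨ ∑<-cong (e ^ s) (λ i _ → 𝟙-× (suc j ∣? e) (cofactor? i)) ⟩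
  ∑[ i < e ^ s ] (𝟙 (suc j ∣? e) * 𝟙 (cofactor? i))    ≡⟨ ∑<-*ˡ (e ^ s) (𝟙 (suc j ∣? e)) (λ i → 𝟙 (cofactor? i)) ⟩
  𝟙 (suc j ∣? e) * ∑[ i < e ^ s ] 𝟙 (cofactor? i)      ≡⟨ 𝟙-*-cong (suc j ∣? e) count ⟩
  𝟙 (suc j ∣? e) * Φ s (suc j ^ s)                     ∎
  where
  open ≡-Reasoning
  cofactor? : ∀ i → Dec (HasCofactor s e (suc i) (suc j))
  cofactor? i = hasCofactor? s e (suc i) (suc j)
  count : suc j ∣ e → ∑[ i < e ^ s ] 𝟙 (cofactor? i) ≡ Φ s (suc j ^ s)
  count 1+j∣e = subst (λ e → ∑[ i < e ^ s ] 𝟙 (hasCofactor? s e (suc i) (suc j)) ≡ Φ s (suc j ^ s))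
                      (sym e≡c*[1+j]) (count-hasCofactor s c (suc j) 1≤s 1≤c (s≤s z≤n))
    where
    c = quotient 1+j∣e
    e≡c*[1+j] : e ≡ c * suc j
    e≡c*[1+j] = m∣n⇒n≡quotient*m 1+j∣e
    1≤c : 1 ≤ c
    1≤c = 1≤m*n⇒1≤m (subst (1 ≤_) e≡c*[1+j] 1≤e)

-- Jordan-type identity e ^ s = ∑_{j ∣ e} Φ_s(j ^ s): sort the x ≤ e ^ s by their cofactor.
^≡∑Φ : ∀ s e B → 1 ≤ s → 1 ≤ e → e ≤ B → e ^ s ≡ ∑[ j < B ] (𝟙 (suc j ∣? e) * Φ s (suc j ^ s))
^≡∑Φ s e B 1≤s 1≤e e≤B = begin
  e ^ s                                             ≡⟨ sym (trans (∑<-const (e ^ s) 1) (*-identityʳ (e ^ s))) ⟩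
  ∑[ i < e ^ s ] 1                                  ≡⟨ ∑<-cong (e ^ s) (λ i _ → sym (cofactor-unique s e B (suc i) 1≤s 1≤e e≤B)) ⟩
  ∑[ i < e ^ s ] ∑[ j < B ] 𝟙 (cofactor? i j)       ≡⟨ ∑<-swap (e ^ s) B (λ i j → 𝟙 (cofactor? i j)) ⟩
  ∑[ j < B ] ∑[ i < e ^ s ] 𝟙 (cofactor? i j)       ≡⟨ ∑<-cong B (λ j _ → cofactor-count s e j 1≤s 1≤e) ⟩
  ∑[ j < B ] (𝟙 (suc j ∣? e) * Φ s (suc j ^ s))     ∎
  where
  open ≡-Reasoning
  cofactor? : ∀ i j → Dec (suc j ∣ e × HasCofactor s e (suc i) (suc j))
  cofactor? i j = (suc j ∣? e) ×-dec hasCofactor? s e (suc i) (suc j)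

-- Sums over tuples of reduced residues

differences : ∀ {k} → Vec ℕ k → Vec ℤ k → List ℤ
differences ms as = Vec.toList (Vec.zipWith (λ m a → ℤ.+ m ℤ.- a) ms as)

allCongruent : ∀ {k} → ℕ → Vec ℕ k → Vec ℤ k → ℕ
allCongruent D []       []       = 1
allCongruent D (m ∷ ms) (a ∷ as) = 𝟙 (D ∣? ∣ ℤ.+ m ℤ.- a ∣) * allCongruent D ms as

allCongruent≡𝟙 : ∀ {k} D (ms : Vec ℕ k) (as : Vec ℤ k) →
                 allCongruent D ms as ≡ 𝟙 (all? (λ x → D ∣? ∣ x ∣) (differences ms as))
allCongruent≡𝟙 D []       []       = refl
allCongruent≡𝟙 D (m ∷ ms) (a ∷ as) = begin
  𝟙 head? * allCongruent D ms as     ≡⟨ cong (𝟙 head? *_) (allCongruent≡𝟙 D ms as) ⟩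
  𝟙 head? * 𝟙 tail?                  ≡⟨ sym (𝟙-× head? tail?) ⟩
  𝟙 (head? ×-dec tail?)              ≡⟨ 𝟙-cong (λ (p , ps) → p All.∷ ps) (λ { (p All.∷ ps) → p , ps }) _ _ ⟩
  𝟙 (all? (λ x → D ∣? ∣ x ∣) (differences (m ∷ ms) (a ∷ as))) ∎
  where
  open ≡-Reasoning
  head? = D ∣? ∣ ℤ.+ m ℤ.- a ∣
  tail? = all? (λ x → D ∣? ∣ x ∣) (differences ms as)

gcdₛ-differences≡∑ : ∀ s n {k} (ms : Vec ℕ k) (as : Vec ℤ k) → 1 ≤ s → 1 ≤ n →
  gcdₛ s (differences ms as ++ ℤ.+ (n ^ s) ∷ []) ≡
  ∑[ i < n ^ s ] (𝟙 (suc i ^ s ∣? n ^ s) * (allCongruent (suc i ^ s) ms as * Φ s (suc i ^ s)))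
gcdₛ-differences≡∑ s n ms as 1≤s 1≤n = begin
  gcdₛ s (diffs ++ ℤ.+ N ∷ [])                          ≡⟨ G.gcdₛ≡root^s ⟩
  G.root ^ s                                            ≡⟨ ^≡∑Φ s G.root N 1≤s G.1≤root root≤N ⟩
  ∑[ i < N ] (𝟙 (suc i ∣? G.root) * Φ s (suc i ^ s))    ≡⟨ ∑<-cong N (λ i _ → term i) ⟩
  ∑[ i < N ] (𝟙 (suc i ^ s ∣? N) * (allCongruent (suc i ^ s) ms as * Φ s (suc i ^ s))) ∎
  where
  open ≡-Reasoning
  N = n ^ s
  diffs = differences ms as
  N∈ = ∈-++⁺ʳ diffs (here refl)
  module G = GcdₛRoot (gcdₛRoot s (diffs ++ ℤ.+ N ∷ []) 1≤s N∈ (1≤m^n s 1≤n))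
  root≤N : G.root ≤ N
  root≤N = ≤-trans (m≤m^n s 1≤s G.1≤root) (∣⇒≤ {{>-nonZero (1≤m^n s 1≤n)}} (All.lookup G.root^s∣all N∈))
  term : ∀ i → 𝟙 (suc i ∣? G.root) * Φ s (suc i ^ s) ≡
               𝟙 (suc i ^ s ∣? N) * (allCongruent (suc i ^ s) ms as * Φ s (suc i ^ s))
  term i = trans (cong (_* Φ s D) 𝟙∣root) (*-assoc (𝟙 (D ∣? N)) (allCongruent D ms as) (Φ s D))
    where
    D = suc i ^ s
    allDiffs? = all? (λ x → D ∣? ∣ x ∣) diffs
    𝟙∣root : 𝟙 (suc i ∣? G.root) ≡ 𝟙 (D ∣? N) * allCongruent D ms as
    𝟙∣root = begin
      𝟙 (suc i ∣? G.root)                ≡⟨ 𝟙-cong to from (suc i ∣? G.root) ((D ∣? N) ×-dec allDiffs?) ⟩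
      𝟙 ((D ∣? N) ×-dec allDiffs?)        ≡⟨ 𝟙-× (D ∣? N) allDiffs? ⟩
      𝟙 (D ∣? N) * 𝟙 allDiffs?            ≡⟨ cong (𝟙 (D ∣? N) *_) (sym (allCongruent≡𝟙 D ms as)) ⟩
      𝟙 (D ∣? N) * allCongruent D ms as   ∎
      where
      to : suc i ∣ G.root → D ∣ N × All (λ x → D ∣ ∣ x ∣) diffs
      to 1+i∣root with All.++⁻ diffs (G.∣root⇒ (suc i) 1+i∣root)
      ... | D∣diffs , D∣N All.∷ _ = D∣N , D∣diffs
      from : D ∣ N × All (λ x → D ∣ ∣ x ∣) diffs → suc i ∣ G.root
      from (D∣N , D∣diffs) = G.∣root (suc i) (s≤s z≤n) (All.++⁺ D∣diffs (D∣N All.∷ All.[]))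

congruenceCounts : ∀ {k} → ℕ → List ℕ → Vec ℤ k → ℕ
congruenceCounts D L []       = 1
congruenceCounts D L (a ∷ as) = ∑[ m ∈ L ] 𝟙 (D ∣? ∣ ℤ.+ m ℤ.- a ∣) * congruenceCounts D L as

∑-tuples-allCongruent : ∀ D L {k} (as : Vec ℤ k) →
  ∑[ ms ∈ tuples k L ] allCongruent D ms as ≡ congruenceCounts D L as
∑-tuples-allCongruent D L []               = refl
∑-tuples-allCongruent D L {suc k} (a ∷ as) = begin
  ∑ (concat (map rows L)) f                     ≡⟨ ∑-concat (map rows L) f ⟩
  ∑[ mss ∈ map rows L ] ∑ mss f                 ≡⟨ ∑-map L rows (λ mss → ∑ mss f) ⟩
  ∑[ m ∈ L ] ∑ (rows m) f                       ≡⟨ ∑-cong L row ⟩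
  ∑[ m ∈ L ] (δ m * congruenceCounts D L as)    ≡⟨ ∑-*ʳ L (congruenceCounts D L as) δ ⟩
  congruenceCounts D L (a ∷ as)                 ∎
  where
  open ≡-Reasoning
  rows : ℕ → List (Vec ℕ (suc k))
  rows m = map (m ∷_) (tuples k L)
  f : Vec ℕ (suc k) → ℕ
  f ms = allCongruent D ms (a ∷ as)
  δ : ℕ → ℕ
  δ m = 𝟙 (D ∣? ∣ ℤ.+ m ℤ.- a ∣)
  row : ∀ m → ∑ (rows m) f ≡ δ m * congruenceCounts D L as
  row m = begin
    ∑ (rows m) f                                        ≡⟨ ∑-map (tuples k L) (m ∷_) f ⟩
    ∑[ ms ∈ tuples k L ] (δ m * allCongruent D ms as)   ≡⟨ ∑-*ˡ (tuples k L) (δ m) (λ ms → allCongruent D ms as) ⟩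
    δ m * ∑[ ms ∈ tuples k L ] allCongruent D ms as     ≡⟨ cong (δ m *_) (∑-tuples-allCongruent D L as) ⟩
    δ m * congruenceCounts D L as                       ∎

congruenceCounts*Φ^k : ∀ {s n d} → 1 ≤ s → 1 ≤ n → 1 ≤ d → d ∣ n → ∀ {k} (as : Vec ℤ k) →
  (∀ i → Reduced s (n ^ s) (lookup as i)) →
  congruenceCounts (d ^ s) (reducedₛ s (n ^ s)) as * Φ s (d ^ s) ^ k ≡ Φ s (n ^ s) ^ k
congruenceCounts*Φ^k 1≤s 1≤n 1≤d d∣n []               _       = refl
congruenceCounts*Φ^k {s} {n} {d} 1≤s 1≤n 1≤d d∣n {suc k} (a ∷ as) reduced = begin
  residueCount a * C * (Φ s D * Φ s D ^ k)   ≡⟨ interchange (residueCount a) C (Φ s D) (Φ s D ^ k) ⟩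
  residueCount a * Φ s D * (C * Φ s D ^ k)   ≡⟨ cong₂ _*_ (sym (Φ≡residueCount*Φ a a-free))
                                                          (congruenceCounts*Φ^k 1≤s 1≤n 1≤d d∣n as (reduced ∘ Fin.suc)) ⟩
  Φ s (n ^ s) * Φ s (n ^ s) ^ k              ∎
  where
  open ≡-Reasoning
  open ResidueClasses 1≤s 1≤n 1≤d d∣n
  C = congruenceCounts D (reducedₛ s N) as
  a-free = reduced⇒primePowerFreeᵈ a (reduced Fin.zero)
  interchange : ∀ a b c d → a * b * (c * d) ≡ a * c * (b * d)
  interchange = solve-∀

lhs≡∑-divisors : ∀ k n s → 1 ≤ s → 1 ≤ n → (as : Vec ℤ k) →
  lhs k n s as ≡ ∑[ d ∈ range1 (n ^ s) ]
                   (𝟙 (d ^ s ∣? n ^ s) * (congruenceCounts (d ^ s) (reducedₛ s (n ^ s)) as * Φ s (d ^ s)))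
lhs≡∑-divisors k n s 1≤s 1≤n as = begin
  ∑[ ms ∈ T ] gcdₛ s (differences ms as ++ ℤ.+ N ∷ [])   ≡⟨ ∑-cong T (λ ms → gcdₛ-differences≡∑ s n ms as 1≤s 1≤n) ⟩
  ∑[ ms ∈ T ] ∑[ i < N ] h (suc i) ms                    ≡⟨ ∑-∑<-swap T N (λ ms i → h (suc i) ms) ⟩
  ∑[ i < N ] ∑[ ms ∈ T ] h (suc i) ms                    ≡⟨ ∑<-cong N (λ i _ → column (suc i)) ⟩
  ∑[ i < N ] H (suc i)                                   ≡⟨ sym (∑-range1 N H) ⟩
  ∑[ d ∈ range1 N ] H d                                  ∎
  where
  open ≡-Reasoning
  N = n ^ s
  T = tuples k (reducedₛ s N)
  h : ℕ → Vec ℕ k → ℕ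
  h d ms = 𝟙 (d ^ s ∣? N) * (allCongruent (d ^ s) ms as * Φ s (d ^ s))
  H : ℕ → ℕ
  H d = 𝟙 (d ^ s ∣? N) * (congruenceCounts (d ^ s) (reducedₛ s N) as * Φ s (d ^ s))
  column : ∀ d → ∑[ ms ∈ T ] h d ms ≡ H d
  column d = begin
    ∑[ ms ∈ T ] h d ms                                              ≡⟨ ∑-*ˡ T (𝟙 (d ^ s ∣? N)) _ ⟩
    𝟙 (d ^ s ∣? N) * ∑[ ms ∈ T ] (allCongruent (d ^ s) ms as * Φ s (d ^ s))
                                                                    ≡⟨ cong (𝟙 (d ^ s ∣? N) *_) (∑-*ʳ T (Φ s (d ^ s)) _) ⟩
    𝟙 (d ^ s ∣? N) * (∑[ ms ∈ T ] allCongruent (d ^ s) ms as * Φ s (d ^ s))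
                                                                    ≡⟨ cong (λ x → 𝟙 (d ^ s ∣? N) * (x * Φ s (d ^ s)))
                                                                         (∑-tuples-allCongruent (d ^ s) (reducedₛ s N) as) ⟩
    H d                                                             ∎

toℚᵘ-toℚ : ∀ n → ℚ.toℚᵘ (toℚ n) ℚᵘ.≃ mkℚᵘ (ℤ.+ n) 0
toℚᵘ-toℚ n = ℚ.toℚᵘ-fromℚᵘ (mkℚᵘ (ℤ.+ n) 0)

toℚ-+ : ∀ m n → toℚ (m + n) ≡ toℚ m ℚ.+ toℚ n
toℚ-+ m n = ℚ.toℚᵘ-injective (ℚᵘ.≃-trans (toℚᵘ-toℚ (m + n)) (ℚᵘ.≃-trans sum≃
  (ℚᵘ.≃-sym (ℚᵘ.≃-trans (ℚ.toℚᵘ-homo-+ (toℚ m) (toℚ n)) (ℚᵘ.+-cong (toℚᵘ-toℚ m) (toℚᵘ-toℚ n))))))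
  where
  sum≃ : mkℚᵘ (ℤ.+ (m + n)) 0 ℚᵘ.≃ mkℚᵘ (ℤ.+ m) 0 ℚᵘ.+ mkℚᵘ (ℤ.+ n) 0
  sum≃ = *≡* (trans (cong (ℤ._* ℤ.+ 1) (ℤ.pos-+ m n)) (normalise (ℤ.+ m) (ℤ.+ n)))
    where
    normalise : ∀ x y → (x ℤ.+ y) ℤ.* ℤ.+ 1 ≡ (x ℤ.* ℤ.+ 1 ℤ.+ y ℤ.* ℤ.+ 1) ℤ.* ℤ.+ 1
    normalise = ℤ.solve-∀

toℚ-*-recipℕ : ∀ m n → toℚ (m * suc n) ℚ.* recipℕ (suc n) ≡ toℚ m
toℚ-*-recipℕ m n = ℚ.toℚᵘ-injective (ℚᵘ.≃-trans (ℚ.toℚᵘ-homo-* (toℚ (m * suc n)) (recipℕ (suc n)))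
  (ℚᵘ.≃-trans (ℚᵘ.*-cong (toℚᵘ-toℚ (m * suc n)) (ℚ.toℚᵘ-fromℚᵘ (mkℚᵘ (ℤ.+ 1) n))) (ℚᵘ.≃-trans cancel≃ (ℚᵘ.≃-sym (toℚᵘ-toℚ m)))))
  where
  cancel≃ : mkℚᵘ (ℤ.+ (m * suc n)) 0 ℚᵘ.* mkℚᵘ (ℤ.+ 1) n ℚᵘ.≃ mkℚᵘ (ℤ.+ m) 0
  cancel≃ = *≡* (trans (cong (λ z → (z ℤ.* ℤ.+ 1) ℤ.* ℤ.+ 1) (ℤ.pos-* m (suc n)))
                (trans (normalise (ℤ.+ m) (ℤ.+ suc n)) (cong (ℤ.+ m ℤ.*_) (sym (ℤ.pos-* 1 (suc n))))))
    where
    normalise : ∀ a b → a ℤ.* b ℤ.* ℤ.+ 1 ℤ.* ℤ.+ 1 ≡ a ℤ.* (ℤ.+ 1 ℤ.* b)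
    normalise = ℤ.solve-∀

∑ℚ : ∀ {a} {A : Set a} → List A → (A → ℚ) → ℚ
∑ℚ xs f = sumℚ (map f xs)

syntax ∑ℚ xs (λ x → e) = ∑ℚ[ x ∈ xs ] e

when : ∀ {p} {P : Set p} → Dec P → ℚ → ℚ
when (yes _) q = q
when (no _)  _ = 0ℚ

module _ {a} {A : Set a} where

  toℚ-∑ : (xs : List A) (f : A → ℕ) → toℚ (∑ xs f) ≡ ∑ℚ[ x ∈ xs ] toℚ (f x)
  toℚ-∑ []       f = refl
  toℚ-∑ (x ∷ xs) f = trans (toℚ-+ (f x) (∑ xs f)) (cong (toℚ (f x) ℚ.+_) (toℚ-∑ xs f))

  ∑ℚ-cong : (xs : List A) {f g : A → ℚ} → (∀ x → f x ≡ g x) → ∑ℚ xs f ≡ ∑ℚ xs g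
  ∑ℚ-cong []       _   = refl
  ∑ℚ-cong (x ∷ xs) f≡g = cong₂ ℚ._+_ (f≡g x) (∑ℚ-cong xs f≡g)

  ∑ℚ-filter : ∀ {p} {P : A → Set p} (P? : ∀ x → Dec (P x)) (xs : List A) (f : A → ℚ) →
              ∑ℚ (filter P? xs) f ≡ ∑ℚ[ x ∈ xs ] when (P? x) (f x)
  ∑ℚ-filter P? []       f = refl
  ∑ℚ-filter P? (x ∷ xs) f with P? x
  ... | yes _ = cong (f x ℚ.+_) (∑ℚ-filter P? xs f)
  ... | no _  = trans (∑ℚ-filter P? xs f) (sym (ℚ.+-identityˡ _))

  ∑ℚ-*ˡ : (c : ℚ) (xs : List A) (f : A → ℚ) → c ℚ.* ∑ℚ xs f ≡ ∑ℚ[ x ∈ xs ] (c ℚ.* f x)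
  ∑ℚ-*ˡ c []       f = ℚ.*-zeroʳ c
  ∑ℚ-*ˡ c (x ∷ xs) f = trans (ℚ.*-distribˡ-+ c (f x) (∑ℚ xs f)) (cong (c ℚ.* f x ℚ.+_) (∑ℚ-*ˡ c xs f))

Φ-positive : ∀ s d → 1 ≤ s → 1 ≤ d → 1 ≤ Φ s (d ^ s)
Φ-positive s d 1≤s 1≤d = subst (1 ≤_) (sym (Φ≡∑< s (d ^ s))) (count (d ^ s) refl)
  where
  count : ∀ D → D ≡ d ^ s → 1 ≤ ∑[ i < D ] 𝟙 (reduced? s (d ^ s) (ℤ.+ suc i))
  count zero    0≡d^s = ⊥-elim (<-irrefl 0≡d^s (1≤m^n s 1≤d))
  count (suc D) _     = subst (1 ≤_) (sym (∑<-suc D _))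
    (≤-trans (≤-reflexive (sym (𝟙-yes (reduced? s (d ^ s) (ℤ.+ 1)) (reduced-1 s d 1≤s 1≤d)))) (m≤m+n _ _))

^∣^⇒1≤base : ∀ s {d n} → 1 ≤ s → 1 ≤ n → d ^ s ∣ n ^ s → 1 ≤ d
^∣^⇒1≤base (suc s) {zero}  _ 1≤n 0∣n^s = ⊥-elim (<-irrefl (sym (0∣⇒≡0 0∣n^s)) (1≤m^n (suc s) 1≤n))
^∣^⇒1≤base s       {suc d} _ _   _     = s≤s z≤n

toℚ-divisorTerm : ∀ {s n k} → 1 ≤ s → 1 ≤ n → (as : Vec ℤ (suc k)) → (∀ i → Reduced s (n ^ s) (lookup as i)) → ∀ d →
  toℚ (𝟙 (d ^ s ∣? n ^ s) * (congruenceCounts (d ^ s) (reducedₛ s (n ^ s)) as * Φ s (d ^ s)))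
  ≡ toℚ (Φ s (n ^ s) ^ suc k) ℚ.* when (d ^ s ∣? n ^ s) (recipℕ (Φ s (d ^ s) ^ k))
toℚ-divisorTerm {s} {n} {k} 1≤s 1≤n as reduced d = byCases (d ^ s ∣? n ^ s)
  where
  open ≡-Reasoning
  C = congruenceCounts (d ^ s) (reducedₛ s (n ^ s)) as
  Φᵈ = Φ s (d ^ s)
  byCases : (P? : Dec (d ^ s ∣ n ^ s)) → toℚ (𝟙 P? * (C * Φᵈ)) ≡ toℚ (Φ s (n ^ s) ^ suc k) ℚ.* when P? (recipℕ (Φᵈ ^ k))
  byCases (no _)        = sym (ℚ.*-zeroʳ (toℚ (Φ s (n ^ s) ^ suc k)))
  byCases (yes d^s∣n^s) = begin
    toℚ (1 * (C * Φᵈ))                         ≡⟨ cong toℚ (*-identityˡ (C * Φᵈ)) ⟩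
    toℚ (C * Φᵈ)                               ≡⟨ sym (toℚ-*-recipℕ (C * Φᵈ) r) ⟩
    toℚ (C * Φᵈ * suc r) ℚ.* recipℕ (suc r)    ≡⟨ cong₂ (λ a b → toℚ a ℚ.* recipℕ b) C*Φᵈ^[1+k]≡Φⁿ^[1+k] 1+r≡Φᵈ^k ⟩
    toℚ (Φ s (n ^ s) ^ suc k) ℚ.* recipℕ (Φᵈ ^ k) ∎
    where
    1≤d = ^∣^⇒1≤base s 1≤s 1≤n d^s∣n^s
    r = pred (Φᵈ ^ k)
    1+r≡Φᵈ^k : suc r ≡ Φᵈ ^ k
    1+r≡Φᵈ^k = suc-pred (Φᵈ ^ k) {{>-nonZero (1≤m^n k (Φ-positive s d 1≤s 1≤d))}}
    C*Φᵈ^[1+k]≡Φⁿ^[1+k] : C * Φᵈ * suc r ≡ Φ s (n ^ s) ^ suc k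
    C*Φᵈ^[1+k]≡Φⁿ^[1+k] = trans (cong (C * Φᵈ *_) 1+r≡Φᵈ^k) (trans (*-assoc C Φᵈ (Φᵈ ^ k))
      (congruenceCounts*Φ^k 1≤s 1≤n 1≤d (^∣^⇒∣ s 1≤s 1≤d d^s∣n^s) as reduced))

corollary3p4 : (k n s : ℕ) → k ≥ 1 → n ≥ 1 → s ≥ 1 → (as : Vec ℤ k) →
    (∀ (i : Fin k) → gcdₛ s (lookup as i ∷ Data.Integer.+ (n ^ s) ∷ []) ≡ 1) →
    toℚ (lhs k n s as) ≡ rhs k n s
corollary3p4 (suc k) n s _ 1≤n 1≤s as reduced = begin
  toℚ (lhs (suc k) n s as)                      ≡⟨ cong toℚ (lhs≡∑-divisors (suc k) n s 1≤s 1≤n as) ⟩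
  toℚ (∑[ d ∈ range1 N ] term d)                ≡⟨ toℚ-∑ (range1 N) term ⟩
  ∑ℚ[ d ∈ range1 N ] toℚ (term d)               ≡⟨ ∑ℚ-cong (range1 N) (toℚ-divisorTerm 1≤s 1≤n as reduced) ⟩
  ∑ℚ[ d ∈ range1 N ] (c ℚ.* when (P? d) (F d))  ≡⟨ sym (∑ℚ-*ˡ c (range1 N) (λ d → when (P? d) (F d))) ⟩
  c ℚ.* ∑ℚ[ d ∈ range1 N ] when (P? d) (F d)    ≡⟨ cong (c ℚ.*_) (sym (∑ℚ-filter P? (range1 N) F)) ⟩
  rhs (suc k) n s                               ∎
  where
  open ≡-Reasoning
  N = n ^ s
  P? : ∀ d → Dec (d ^ s ∣ N)
  P? d = d ^ s ∣? N
  term : ℕ → ℕ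
  term d = 𝟙 (P? d) * (congruenceCounts (d ^ s) (reducedₛ s N) as * Φ s (d ^ s))
  F : ℕ → ℚ
  F d = recipℕ (Φ s (d ^ s) ^ k)
  c = toℚ (Φ s N ^ suc k)
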